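{- Let $A\mapsto A_{\neg\neg}$ be the $\neg\neg$-interpretation of QHC in QH, defined recursively as follows. Fix an injective assignment $p\mapsto\hat p$ of a predicate variable of QH of the same arity to each proper predicate variable, disjoint from the problem variables, which are kept as they are. Then: - $(\alpha(x_1,\dots,x_n))_{\neg\neg}=\alpha(x_1,\dots,x_n)$; - $\checkmark$ and $\curlywedge$ are unchanged; - intuitionistic connectives and quantifiers are preserved; - $(!F)_{\neg\neg}=F_{\neg\neg}$; - $(p(x_1,\dots,x_n))_{\neg\neg}=\neg\neg\hat p(x_1,\dots,x_n)$; - $\top_{\neg\neg}=\checkmark$ and $\bot_{\neg\neg}=\curlywedge$; - for each classical binary connective $\circ$, $(F\circ G)_{\neg\neg}=\neg\neg(F_{\neg\neg}\circ G_{\neg\neg})$ with $\circ$ now intuitionistic; - $(\neg F)_{\neg\neg}=\neg\neg\neg F_{\neg\neg}$; - $(\exists x\,F)_{\neg\neg}=\neg\neg\exists x\,F_{\neg\neg}$ and $(\forall x\,F)_{\neg\neg}=\neg\neg\forall x\,F_{\neg\neg}$; - $(?\Phi)_{\neg\neg}=\neg\neg\Phi_{\neg\neg}$. If $A_1,\dots,A_n,A$ are formulas of QHC with $A_1,\dots,A_n\vdash_{QHC}A$, then $(A_1)_{\neg\neg},\dots,(A_n)_{\neg\neg}\vdash_{QH}A_{\neg\neg}$.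
   Context: Meta-logical framework. Formulas of a first-order language may contain individual variables and predicate variables. Meta-formulas are built from formulas using meta-conjunction $\&$, meta-implication $\Rightarrow$, and universal meta-quantifiers over individual and predicate variables. A principle $\cdot G$, for a formula $G$, is the meta-formula obtained by universally meta-quantifying all free individual variables of $G$ and then all predicate variables of $G$. A rule $F_1,\dots,F_m/G$ is the meta-formula $\forall^2(\forall^1F_1\,\&\cdots\&\,\forall^1F_m\Rightarrow\forall^1G)$, where $\forall^1$ meta-quantifies the free individual variables of the formula it precedes and $\forall^2$ meta-quantifies all predicate variables occurring. A logic $L$ is given by a derivation system $\mathcal D$, a meta-conjunction of finitely many principles and rules. For a meta-formula $\mathcal F$, $\vdash_L\mathcal F$ means that $\mathcal D\Rightarrow\mathcal F$ is derivable by the natural-deduction meta-rules: introduction and elimination of $\&$, $\Rightarrow$ and the universal meta-quantifiers (elimination allows substituting terms for individual variables and formulas for predicate variables), plus $\alpha$-conversion. The notation $\mathcal F_1,\dots,\mathcal F_m\vdash_L\mathcal G$ means $\vdash_L(\mathcal F_1\&\cdots\&\mathcal F_m)\Rightarrow\mathcal G$. A formula by itself is a meta-formula, with its free variables not generalized. Language of QHC. It has individual variables and, for each $n\ge0$, countably many $n$-ary problem variables $\alpha,\beta,\gamma,\delta,\theta,\dots$ and countably many $n$-ary proper predicate variables $p,q,\dots$. - A c-formula is $\top$, $\bot$, an atom $p(x_1,\dots,x_n)$, or $?\Phi$ for an i-formula $\Phi$, closed under the classical connectives $\land,\lor,\to,\leftrightarrow,\neg$ and quantifiers $\exists,\forall$.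 - An i-formula is $\checkmark$ (triviality), $\curlywedge$ (absurdity), an atom $\alpha(x_1,\dots,x_n)$, or $!F$ for a c-formula $F$, closed under the intuitionistic connectives $\land,\lor,\to,\leftrightarrow,\neg$ (with $\neg\Phi:=\Phi\to\curlywedge$) and quantifiers $\exists,\forall$. Connectives applied to c-formulas are classical; those applied to i-formulas are intuitionistic. QHC is the logic whose derivation system consists of: - (0a) all laws and rules of classical predicate logic QC, for c-formulas; - (0b) all laws and rules of intuitionistic predicate logic QH, for i-formulas; - the principles $\cdot\,?(\gamma\land\delta)\leftrightarrow ?\gamma\land ?\delta$, $\cdot\,?(\gamma\lor\delta)\leftrightarrow ?\gamma\lor ?\delta$, $\cdot\,?(\gamma\to\delta)\to(?\gamma\to ?\delta)$, $\cdot\,\neg ?\curlywedge$, $\cdot\,?\exists x\,\theta(x)\leftrightarrow\exists x\,?\theta(x)$, $\cdot\,?\forall x\,\theta(x)\to\forall x\,?\theta(x)$, $\cdot\,\gamma\to\,!?\gamma$, $\cdot\,\neg !\bot$, $\cdot\,?!p\to p$, $\cdot\,!p\to\,!?!p$ and $\cdot\,!(p\to q)\to(!p\to !q)$; - the rules $!p/p$ and $p/!p$. QH is intuitionistic predicate logic, with absurdity constant $\curlywedge$. -}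

module Defs where

open import Data.Nat.Base using (ℕ; zero; suc; pred; _≡ᵇ_; _<ᵇ_)
open import Data.Nat.Properties using (_≟_)
open import Data.Bool.Base using (Bool; true; false; if_then_else_) renaming (_∧_ to _and_)
open import Data.List.Base using (List; []; _∷_; map)
open import Data.List.Membership.Propositional using (_∈_)
open import Data.Product.Base using (Σ; _×_; _,_)
open import Data.Vec.Base using (Vec; []; _∷_)
import Data.Vec.Base as V
open import Relation.Nullary using (yes; no; Dec)
open import Relation.Binary.PropositionalEquality using (_≡_; refl)

-- Conventions
-- * Terms are individual variables only, in de Bruijn notation (ℕ);
--   a free index is a free individual variable, binders (object-level
--   ∃/∀ and the meta-level ∀¹) bind index 0.
-- * Predicate variables are grouped in kinds; within each kind they are
--   de Bruijn indices (ℕ).  The meta-level ∀² over kind k binds index 0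
--   of kind k.  A free index is a free predicate variable.
-- * Hence α-conversion is syntactic identity.

ext : (ℕ → ℕ) → ℕ → ℕ
ext ρ zero    = zero
ext ρ (suc i) = suc (ρ i)

extN : ℕ → (ℕ → ℕ) → ℕ → ℕ
extN zero    ρ = ρ
extN (suc n) ρ = ext (extN n ρ)

sub0 : ℕ → ℕ → ℕ
sub0 t zero    = t
sub0 t (suc i) = i

-- instantiation of the argument places 0..n-1 of a formula substituted
-- for an n-ary predicate variable, at binder depth d: argument place i
-- goes to the i-th argument, a parameter n+k goes to k+d.
inst : ∀ {n} → Vec ℕ n → ℕ → ℕ → ℕ
inst []       d i       = i Data.Nat.Base.+ d
inst (a ∷ as) d zero    = a
inst (a ∷ as) d (suc i) = inst as d i

record Lang : Set₁ where
  field
    Kind   : Set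
    eqK    : Kind → Kind → Bool
    Form   : Set
    Inst   : Kind → Set                -- what may be substituted for a
                                       -- predicate variable of kind k
    renI      : (ℕ → ℕ) → Form → Form
    renIInst  : (k : Kind) → (ℕ → ℕ) → Inst k → Inst k
      -- rename the parameters (not the argument places) of an instance
    shiftP    : Kind → ℕ → Form → Form  -- +1 on kind-k indices ≥ cutoff
    shiftPInst : Kind → ℕ → (k : Kind) → Inst k → Inst k
    substP    : (k : Kind) → ℕ → Inst k → Form → Form
      -- substP k j G F: substitute G for kind-k variable j in F
      -- (capture-free), decrementing kind-k indices > j

module Meta (L : Lang) where
  open Lang L

  infixr 6 _&_
  infixr 5 _⟹_

  data MF : Set where
    atom : Form → MF
    _&_  : MF → MF → MF
    _⟹_ : MF → MF → MF
    ∀¹   : MF → MF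
    ∀²   : Kind → MF → MF

  mrenI : (ℕ → ℕ) → MF → MF
  mrenI ρ (atom F) = atom (renI ρ F)
  mrenI ρ (M & N)  = mrenI ρ M & mrenI ρ N
  mrenI ρ (M ⟹ N) = mrenI ρ M ⟹ mrenI ρ N
  mrenI ρ (∀¹ M)   = ∀¹ (mrenI (ext ρ) M)
  mrenI ρ (∀² k M) = ∀² k (mrenI ρ M)

  mshiftP : Kind → ℕ → MF → MF
  mshiftP k c (atom F)  = atom (shiftP k c F)
  mshiftP k c (M & N)   = mshiftP k c M & mshiftP k c N
  mshiftP k c (M ⟹ N)  = mshiftP k c M ⟹ mshiftP k c N
  mshiftP k c (∀¹ M)    = ∀¹ (mshiftP k c M)
  mshiftP k c (∀² k' M) = ∀² k' (mshiftP k (if eqK k' k then suc c else c) M)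

  msubstP : (k : Kind) → ℕ → Inst k → MF → MF
  msubstP k j G (atom F)  = atom (substP k j G F)
  msubstP k j G (M & N)   = msubstP k j G M & msubstP k j G N
  msubstP k j G (M ⟹ N)  = msubstP k j G M ⟹ msubstP k j G N
  msubstP k j G (∀¹ M)    = ∀¹ (msubstP k j (renIInst k suc G) M)
  msubstP k j G (∀² k' M) =
    ∀² k' (msubstP k (if eqK k' k then suc j else j) (shiftPInst k' 0 k G) M)

  data ND : List MF → MF → Set where
    hyp  : ∀ {Γ M} → M ∈ Γ → ND Γ M
    &I   : ∀ {Γ M N} → ND Γ M → ND Γ N → ND Γ (M & N)
    &E₁  : ∀ {Γ M N} → ND Γ (M & N) → ND Γ M
    &E₂  : ∀ {Γ M N} → ND Γ (M & N) → ND Γ N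
    ⟹I  : ∀ {Γ M N} → ND (M ∷ Γ) N → ND Γ (M ⟹ N)
    ⟹E  : ∀ {Γ M N} → ND Γ (M ⟹ N) → ND Γ M → ND Γ N
    ∀¹I  : ∀ {Γ M} → ND (map (mrenI suc) Γ) M → ND Γ (∀¹ M)
    ∀¹E  : ∀ {Γ M} → ND Γ (∀¹ M) → (t : ℕ) → ND Γ (mrenI (sub0 t) M)
    ∀²I  : ∀ {Γ M k} → ND (map (mshiftP k 0) Γ) M → ND Γ (∀² k M)
    ∀²E  : ∀ {Γ M k} → ND Γ (∀² k M) → (G : Inst k) → ND Γ (msubstP k 0 G M)

  -- F₁,…,Fₘ ⊢ G  is  (F₁ & ⋯ & Fₘ) ⟹ G   (just G when m = 0)
  conj : Form → List Form → MF
  conj F []       = atom F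
  conj F (G ∷ Gs) = atom F & conj G Gs

  entails : List Form → Form → MF
  entails []       G = atom G
  entails (F ∷ Fs) G = conj F Fs ⟹ atom G

record Logic : Set₁ where
  field
    lang : Lang
  open Meta lang public
  field
    𝒟 : MF

⊢ : (L : Logic) → Meta.MF (Logic.lang L) → Set
⊢ L ℱ = ND [] (𝒟 ⟹ ℱ)
  where open Logic L

data Sort : Set where
  C I : Sort      -- c-formulas, i-formulas

eqS : Sort → Sort → Bool
eqS C C = true
eqS I I = true
eqS _ _ = false

decS : (s s' : Sort) → Dec (s ≡ s')
decS C C = yes refl
decS I I = yes refl
decS C I = no (λ ())
decS I C = no (λ ())

infixr 8 ¬ᶜ_
infixr 7 _∧_
infixr 6 _∨_
infixr 5 _⇒_
infix  4 _⇔_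

-- Fm C = c-formulas, Fm I = i-formulas.  pv {C} n j args is the proper
-- predicate variable p of arity n with index j; pv {I} n j args is the
-- problem variable α of arity n with index j.  The binary connectives
-- and quantifiers at sort C are the classical ones, at sort I the
-- intuitionistic ones.
data Fm : Sort → Set where
  ⊤ ⊥   : Fm C
  ✓ ⋏   : Fm I
  pv    : ∀ {s} (n j : ℕ) → Vec ℕ n → Fm s
  ¿_    : Fm I → Fm C
  ¡_    : Fm C → Fm I
  _∧_ _∨_ _⇒_ _⇔_ : ∀ {s} → Fm s → Fm s → Fm s
  ¬ᶜ_   : Fm C → Fm C
  ∃̇ ∀̇  : ∀ {s} → Fm s → Fm s

¬ⁱ_ : Fm I → Fm I
¬ⁱ Φ = Φ ⇒ ⋏

renF : ∀ {s} → (ℕ → ℕ) → Fm s → Fm s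
renF ρ ⊤ = ⊤
renF ρ ⊥ = ⊥
renF ρ ✓ = ✓
renF ρ ⋏ = ⋏
renF ρ (pv n j a) = pv n j (V.map ρ a)
renF ρ (¿ F) = ¿ renF ρ F
renF ρ (¡ F) = ¡ renF ρ F
renF ρ (F ∧ G) = renF ρ F ∧ renF ρ G
renF ρ (F ∨ G) = renF ρ F ∨ renF ρ G
renF ρ (F ⇒ G) = renF ρ F ⇒ renF ρ G
renF ρ (F ⇔ G) = renF ρ F ⇔ renF ρ G
renF ρ (¬ᶜ F) = ¬ᶜ renF ρ F
renF ρ (∃̇ F) = ∃̇ (renF (ext ρ) F)
renF ρ (∀̇ F) = ∀̇ (renF (ext ρ) F)

shiftF : Sort → ℕ → ℕ → ∀ {s'} → Fm s' → Fm s'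
shiftF s n c ⊤ = ⊤
shiftF s n c ⊥ = ⊥
shiftF s n c ✓ = ✓
shiftF s n c ⋏ = ⋏
shiftF s n c (pv {s'} n' j a) =
  pv n' (if eqS s s' and (n ≡ᵇ n') and (c Data.Nat.Base.≤ᵇ j) then suc j else j) a
shiftF s n c (¿ F) = ¿ shiftF s n c F
shiftF s n c (¡ F) = ¡ shiftF s n c F
shiftF s n c (F ∧ G) = shiftF s n c F ∧ shiftF s n c G
shiftF s n c (F ∨ G) = shiftF s n c F ∨ shiftF s n c G
shiftF s n c (F ⇒ G) = shiftF s n c F ⇒ shiftF s n c G
shiftF s n c (F ⇔ G) = shiftF s n c F ⇔ shiftF s n c G
shiftF s n c (¬ᶜ F) = ¬ᶜ shiftF s n c F
shiftF s n c (∃̇ F) = ∃̇ (shiftF s n c F)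
shiftF s n c (∀̇ F) = ∀̇ (shiftF s n c F)

substAt : (s : Sort) (n j : ℕ) → Fm s → ℕ →
          (s' : Sort) (n' j' : ℕ) → Vec ℕ n' → Fm s'
substAt s n j G d s' n' j' a with decS s s' | n ≟ n'
... | yes refl | yes refl =
  if j' ≡ᵇ j then renF (inst a d) G
  else (if j <ᵇ j' then pv n (pred j') a else pv n j' a)
... | _ | _ = pv n' j' a

substF : (s : Sort) (n j : ℕ) → Fm s → ℕ → ∀ {s'} → Fm s' → Fm s'
substF s n j G d ⊤ = ⊤
substF s n j G d ⊥ = ⊥
substF s n j G d ✓ = ✓
substF s n j G d ⋏ = ⋏
substF s n j G d (pv {s'} n' j' a) = substAt s n j G d s' n' j' a
substF s n j G d (¿ F) = ¿ substF s n j G d F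
substF s n j G d (¡ F) = ¡ substF s n j G d F
substF s n j G d (F ∧ H) = substF s n j G d F ∧ substF s n j G d H
substF s n j G d (F ∨ H) = substF s n j G d F ∨ substF s n j G d H
substF s n j G d (F ⇒ H) = substF s n j G d F ⇒ substF s n j G d H
substF s n j G d (F ⇔ H) = substF s n j G d F ⇔ substF s n j G d H
substF s n j G d (¬ᶜ F) = ¬ᶜ substF s n j G d F
substF s n j G d (∃̇ F) = ∃̇ (substF s n j G (suc d) F)
substF s n j G d (∀̇ F) = ∀̇ (substF s n j G (suc d) F)

Formula : Set
Formula = Σ Sort Fm

QHCLang : Lang
QHCLang = record
  { Kind = Sort × ℕ
  ; eqK = λ { (s , n) (s' , n') → eqS s s' and (n ≡ᵇ n') }
  ; Form = Formula
  ; Inst = λ { (s , n) → Fm s }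
  ; renI = λ { ρ (s , F) → s , renF ρ F }
  ; renIInst = λ { (s , n) ρ G → renF (extN n ρ) G }
  ; shiftP = λ { (s , n) c (s' , F) → s' , shiftF s n c F }
  ; shiftPInst = λ { (s , n) c (s' , n') G → shiftF s n c G }
  ; substP = λ { (s , n) j G (s' , F) → s' , substF s n j G 0 F }
  }

-- Language of QH: i-formulas over predicate variables of two families
-- (problem variables α, and the hatted variables p̂), each with
-- countably many variables of every arity.

data PName : Set where
  prob hat : PName

eqPN : PName → PName → Bool
eqPN prob prob = true
eqPN hat  hat  = true
eqPN _    _    = false

data QF : Set where
  ✓ ⋏ : QF
  pv  : (b : PName) (n j : ℕ) → Vec ℕ n → QF
  _∧_ _∨_ _⇒_ _⇔_ : QF → QF → QF
  ∃̇ ∀̇ : QF → QF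

¬_ : QF → QF
¬ Φ = Φ ⇒ ⋏

renQ : (ℕ → ℕ) → QF → QF
renQ ρ ✓ = ✓
renQ ρ ⋏ = ⋏
renQ ρ (pv b n j a) = pv b n j (V.map ρ a)
renQ ρ (F ∧ G) = renQ ρ F ∧ renQ ρ G
renQ ρ (F ∨ G) = renQ ρ F ∨ renQ ρ G
renQ ρ (F ⇒ G) = renQ ρ F ⇒ renQ ρ G
renQ ρ (F ⇔ G) = renQ ρ F ⇔ renQ ρ G
renQ ρ (∃̇ F) = ∃̇ (renQ (ext ρ) F)
renQ ρ (∀̇ F) = ∀̇ (renQ (ext ρ) F)

shiftQ : PName → ℕ → ℕ → QF → QF
shiftQ b n c ✓ = ✓
shiftQ b n c ⋏ = ⋏
shiftQ b n c (pv b' n' j a) =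
  pv b' n' (if eqPN b b' and (n ≡ᵇ n') and (c Data.Nat.Base.≤ᵇ j) then suc j else j) a
shiftQ b n c (F ∧ G) = shiftQ b n c F ∧ shiftQ b n c G
shiftQ b n c (F ∨ G) = shiftQ b n c F ∨ shiftQ b n c G
shiftQ b n c (F ⇒ G) = shiftQ b n c F ⇒ shiftQ b n c G
shiftQ b n c (F ⇔ G) = shiftQ b n c F ⇔ shiftQ b n c G
shiftQ b n c (∃̇ F) = ∃̇ (shiftQ b n c F)
shiftQ b n c (∀̇ F) = ∀̇ (shiftQ b n c F)

substQAt : PName → (n j : ℕ) → QF → ℕ → PName → (n' j' : ℕ) → Vec ℕ n' → QF
substQAt b n j G d b' n' j' a with eqPN b b' | n ≟ n'
... | true | yes refl =
  if j' ≡ᵇ j then renQ (inst a d) G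
  else (if j <ᵇ j' then pv b' n (pred j') a else pv b' n j' a)
... | _ | _ = pv b' n' j' a

substQ : PName → (n j : ℕ) → QF → ℕ → QF → QF
substQ b n j G d ✓ = ✓
substQ b n j G d ⋏ = ⋏
substQ b n j G d (pv b' n' j' a) = substQAt b n j G d b' n' j' a
substQ b n j G d (F ∧ H) = substQ b n j G d F ∧ substQ b n j G d H
substQ b n j G d (F ∨ H) = substQ b n j G d F ∨ substQ b n j G d H
substQ b n j G d (F ⇒ H) = substQ b n j G d F ⇒ substQ b n j G d H
substQ b n j G d (F ⇔ H) = substQ b n j G d F ⇔ substQ b n j G d H
substQ b n j G d (∃̇ F) = ∃̇ (substQ b n j G (suc d) F)
substQ b n j G d (∀̇ F) = ∀̇ (substQ b n j G (suc d) F)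

QHLang : Lang
QHLang = record
  { Kind = PName × ℕ
  ; eqK = λ { (b , n) (b' , n') → eqPN b b' and (n ≡ᵇ n') }
  ; Form = QF
  ; Inst = λ _ → QF
  ; renI = renQ
  ; renIInst = λ { (b , n) ρ G → renQ (extN n ρ) G }
  ; shiftP = λ { (b , n) c F → shiftQ b n c F }
  ; shiftPInst = λ { (b , n) c _ G → shiftQ b n c G }
  ; substP = λ { (b , n) j G F → substQ b n j G 0 F }
  }

module QHCM = Meta QHCLang
module QHM  = Meta QHLang

-- the variables used in schemata: 0-ary p,q,r (indices 0,1,2 of the
-- 0-ary kind) and the unary θ (index 0 of the unary kind), applied to x.
module Schemata {A : Set} (_∧'_ _∨'_ _⇒'_ _⇔'_ : A → A → A) (∃' ∀' : A → A)
                (p0 : ℕ → A) (θ : ℕ → A) where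
  private
    p = p0 0
    q = p0 1
    r = p0 2
  posAx : List A
  posAx =
      (r ⇒' (q ⇒' r))
    ∷ ((r ⇒' (q ⇒' p)) ⇒' ((r ⇒' q) ⇒' (r ⇒' p)))
    ∷ ((r ∧' q) ⇒' r)
    ∷ ((r ∧' q) ⇒' q)
    ∷ (r ⇒' (q ⇒' (r ∧' q)))
    ∷ (r ⇒' (r ∨' q))
    ∷ (q ⇒' (r ∨' q))
    ∷ ((r ⇒' p) ⇒' ((q ⇒' p) ⇒' ((r ∨' q) ⇒' p)))
    ∷ ((q ⇔' p) ⇒' (q ⇒' p))
    ∷ ((q ⇔' p) ⇒' (p ⇒' q))
    ∷ ((q ⇒' p) ⇒' ((p ⇒' q) ⇒' (q ⇔' p)))
    ∷ []
  quantAx : List A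
  quantAx = (∀' (θ 0) ⇒' θ 0) ∷ (θ 0 ⇒' ∃' (θ 0)) ∷ []

bigConj : ∀ {L : Lang} → List (Meta.MF L) → Meta.MF L → Meta.MF L
bigConj []       M = M
bigConj (N ∷ Ns) M = Meta._&_ N (bigConj Ns M)

module QHAx where
  open QHM
  k0 k1 : PName × ℕ
  k0 = prob , 0
  k1 = prob , 1
  P : ℕ → QF
  P j = pv prob 0 j []
  Θ : ℕ → QF
  Θ x = pv prob 1 0 (x ∷ [])
  open Schemata _∧_ _∨_ _⇒_ _⇔_ ∃̇ ∀̇ P Θ
  pr3 : QF → MF
  pr3 F = ∀² k0 (∀² k0 (∀² k0 (atom F)))
  principles : List MF
  principles =
      map pr3 posAx
    Data.List.Base.++ map (λ F → ∀² k1 (∀¹ (atom F))) quantAx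
    Data.List.Base.++ (atom ✓ ∷ ∀² k0 (atom (⋏ ⇒ P 0)) ∷ [])
  rules : List MF
  rules =
      ∀² k0 (∀² k0 (atom (P 1) & atom (P 1 ⇒ P 0) ⟹ atom (P 0)))
    ∷ ∀² k0 (∀² k1 (∀¹ (atom (P 0 ⇒ Θ 0)) ⟹ atom (P 0 ⇒ ∀̇ (Θ 0))))
    ∷ ∀² k0 (∀² k1 (∀¹ (atom (Θ 0 ⇒ P 0)) ⟹ atom (∃̇ (Θ 0) ⇒ P 0)))
    ∷ []
  𝒟QH : MF
  𝒟QH = bigConj principles (bigConj rules (atom ✓))

QH : Logic
QH = record { lang = QHLang ; 𝒟 = QHAx.𝒟QH }

module QHCAx where
  open QHCM
  ⌜_⌝ : ∀ {s} → Fm s → MF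
  ⌜_⌝ {s} F = atom (s , F)

  -- laws and rules of QC (s = C) resp. QH (s = I), over the kinds
  -- (s , 0) and (s , 1)
  module Base (s : Sort) (⊥s ⊤s : Fm s) where
    P : ℕ → Fm s
    P j = pv 0 j []
    Θ : ℕ → Fm s
    Θ x = pv 1 0 (x ∷ [])
    open Schemata _∧_ _∨_ _⇒_ _⇔_ ∃̇ ∀̇ P Θ public
    pr3 : Fm s → MF
    pr3 F = ∀² (s , 0) (∀² (s , 0) (∀² (s , 0) ⌜ F ⌝))
    principles : List MF
    principles =
        map pr3 posAx
      Data.List.Base.++ map (λ F → ∀² (s , 1) (∀¹ ⌜ F ⌝)) quantAx
      Data.List.Base.++ (⌜ ⊤s ⌝ ∷ ∀² (s , 0) ⌜ ⊥s ⇒ P 0 ⌝ ∷ [])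
    rules : List MF
    rules =
        ∀² (s , 0) (∀² (s , 0) (⌜ P 1 ⌝ & ⌜ P 1 ⇒ P 0 ⌝ ⟹ ⌜ P 0 ⌝))
      ∷ ∀² (s , 0) (∀² (s , 1) (∀¹ ⌜ P 0 ⇒ Θ 0 ⌝ ⟹ ⌜ P 0 ⇒ ∀̇ (Θ 0) ⌝))
      ∷ ∀² (s , 0) (∀² (s , 1) (∀¹ ⌜ Θ 0 ⇒ P 0 ⌝ ⟹ ⌜ ∃̇ (Θ 0) ⇒ P 0 ⌝))
      ∷ []

  module QCb = Base C ⊥ ⊤
  module QHb = Base I ⋏ ✓

  classical : List MF
  classical =
      ∀² (C , 0) ⌜ ¬ᶜ ¬ᶜ QCb.P 0 ⇒ QCb.P 0 ⌝
    ∷ ∀² (C , 0) ⌜ (QCb.P 0 ⇒ ⊥) ⇒ ¬ᶜ QCb.P 0 ⌝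
    ∷ ∀² (C , 0) ⌜ ¬ᶜ QCb.P 0 ⇒ (QCb.P 0 ⇒ ⊥) ⌝
    ∷ []

  γ δ : Fm I
  γ = pv 0 1 []
  δ = pv 0 0 []
  θ : ℕ → Fm I
  θ x = pv 1 0 (x ∷ [])
  p q : Fm C
  p = pv 0 1 []
  q = pv 0 0 []

  iI0 iI1 cC0 : Sort × ℕ
  iI0 = I , 0
  iI1 = I , 1
  cC0 = C , 0

  hybrid : List MF
  hybrid =
      ∀² iI0 (∀² iI0 ⌜ ¿ (γ ∧ δ) ⇔ ¿ γ ∧ ¿ δ ⌝)
    ∷ ∀² iI0 (∀² iI0 ⌜ ¿ (γ ∨ δ) ⇔ ¿ γ ∨ ¿ δ ⌝)
    ∷ ∀² iI0 (∀² iI0 ⌜ ¿ (γ ⇒ δ) ⇒ (¿ γ ⇒ ¿ δ) ⌝)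
    ∷ ⌜ ¬ᶜ ¿ ⋏ ⌝
    ∷ ∀² iI1 ⌜ ¿ ∃̇ (θ 0) ⇔ ∃̇ (¿ θ 0) ⌝
    ∷ ∀² iI1 ⌜ ¿ ∀̇ (θ 0) ⇒ ∀̇ (¿ θ 0) ⌝
    ∷ ∀² iI0 ⌜ δ ⇒ ¡ ¿ δ ⌝
    ∷ ⌜ ¬ⁱ ¡ ⊥ ⌝
    ∷ ∀² cC0 ⌜ ¿ ¡ q ⇒ q ⌝
    ∷ ∀² cC0 ⌜ ¡ q ⇒ ¡ ¿ ¡ q ⌝
    ∷ ∀² cC0 (∀² cC0 ⌜ ¡ (p ⇒ q) ⇒ (¡ p ⇒ ¡ q) ⌝)
    ∷ ∀² cC0 (⌜ ¡ q ⌝ ⟹ ⌜ q ⌝)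
    ∷ ∀² cC0 (⌜ q ⌝ ⟹ ⌜ ¡ q ⌝)
    ∷ []

  𝒟QHC : MF
  𝒟QHC =
    bigConj QCb.principles (bigConj QCb.rules (bigConj classical
      (bigConj QHb.principles (bigConj QHb.rules (bigConj hybrid ⌜ ⊤ ⌝)))))

QHC : Logic
QHC = record { lang = QHCLang ; 𝒟 = QHCAx.𝒟QHC }

-- The ¬¬-interpretation  A ↦ A¬¬  of QHC in QH.
-- Problem variable α (kind (I,n), index j) ↦ pv prob n j;
-- proper variable p (kind (C,n), index j) ↦ p̂ = pv hat n j.

¬¬_ : QF → QF
¬¬ Φ = ¬ (¬ Φ)

tr : ∀ {s} → Fm s → QF
tr ⊤ = ✓
tr ⊥ = ⋏
tr ✓ = ✓
tr ⋏ = ⋏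
tr (pv {I} n j a) = pv prob n j a
tr (pv {C} n j a) = ¬¬ pv hat n j a
tr (¿ Φ) = ¬¬ tr Φ
tr (¡ F) = tr F
tr (_∧_ {I} F G) = tr F ∧ tr G
tr (_∨_ {I} F G) = tr F ∨ tr G
tr (_⇒_ {I} F G) = tr F ⇒ tr G
tr (_⇔_ {I} F G) = tr F ⇔ tr G
tr (_∧_ {C} F G) = ¬¬ (tr F ∧ tr G)
tr (_∨_ {C} F G) = ¬¬ (tr F ∨ tr G)
tr (_⇒_ {C} F G) = ¬¬ (tr F ⇒ tr G)
tr (_⇔_ {C} F G) = ¬¬ (tr F ⇔ tr G)
tr (¬ᶜ F) = ¬¬ (¬ tr F)
tr (∃̇ {I} F) = ∃̇ (tr F)
tr (∀̇ {I} F) = ∀̇ (tr F)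
tr (∃̇ {C} F) = ¬¬ ∃̇ (tr F)
tr (∀̇ {C} F) = ¬¬ ∀̇ (tr F)

trΣ : Formula → QF
trΣ (s , F) = tr F

_⊢QHC_ : List Formula → Formula → Set
As ⊢QHC A = ⊢ QHC (QHCM.entails As A)

_⊢QH_ : List QF → QF → Set
Φs ⊢QH Φ = ⊢ QH (QHM.entails Φs Φ)

-- A meta-derivation in QHC is translated rule by rule into one in QH.  The
-- obstacle is that QHC instantiates a proper variable p by an arbitrary
-- c-formula G, while p¬¬ = ¬¬p̂ cannot be instantiated to G¬¬.  So the
-- translation of meta-formulas keeps, for proper variables bound by a
-- meta-quantifier ∀²p, the bare variable p̂ together with the hypothesis that p̂
-- is stable (¬¬p̂ → p̂); ∀²p becomes ∀²p̂ (stable p̂ ⟹ …).  Every translated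
-- c-formula is ✓, ⋏, a stable p̂ or of the form ¬¬Φ, hence stable, so
-- instantiating ∀²p̂ by G¬¬ discharges the hypothesis, and the translation
-- commutes with renaming, shifting and substitution.  What remains is to
-- derive in QH the translations of the principles and rules of QHC, which is
-- intuitionistic reasoning under double negation with stable atoms.  For
-- formulas, with no proper variable bound, the translation is A ↦ A¬¬.

module Submission where

open import Defs
open import Data.List.Base using (List; map)

open import Data.Bool.Base using (Bool; true; false; if_then_else_) renaming (_∧_ to _and_)
open import Data.Empty using (⊥-elim)
open import Data.List.Base using ([]; _∷_; _++_)
open import Data.List.Membership.Propositional using (_∈_)
open import Data.List.Membership.Propositional.Properties using (∈-map⁺; ∈-map⁻)
open import Data.List.Relation.Unary.Any using (here; there)
open import Data.List.Relation.Binary.Subset.Propositional using (_⊆_)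
open import Data.List.Relation.Binary.Subset.Propositional.Properties
  using (∷⁺ʳ) renaming (map⁺ to ⊆-map⁺)
open import Data.Nat.Base using (ℕ; zero; suc; pred; _+_; _≤_; _<_; s≤s; _≡ᵇ_; _<ᵇ_; _≤ᵇ_)
open import Data.Nat.Properties using (_≟_; +-identityʳ; +-comm; +-suc; ≤-refl; ≤-trans; n≤1+n)
open import Data.Product.Base using (_,_)
open import Data.Vec.Base using (Vec; []; _∷_)
import Data.Vec.Base as Vec
open import Data.Vec.Properties using (map-cong; map-∘; map-id)
open import Relation.Nullary using (yes; no)
open import Relation.Binary.PropositionalEquality
  using (_≡_; _≢_; refl; sym; trans; cong; cong₂; subst)

open QHM
module Q = QHCM
open QHAx using (𝒟QH)

≡ᵇ-refl : ∀ n → (n ≡ᵇ n) ≡ true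
≡ᵇ-refl zero    = refl
≡ᵇ-refl (suc n) = ≡ᵇ-refl n

≢⇒≡ᵇ-false : ∀ m n → m ≢ n → (m ≡ᵇ n) ≡ false
≢⇒≡ᵇ-false zero    zero    m≢n = ⊥-elim (m≢n refl)
≢⇒≡ᵇ-false zero    (suc n) m≢n = refl
≢⇒≡ᵇ-false (suc m) zero    m≢n = refl
≢⇒≡ᵇ-false (suc m) (suc n) m≢n = ≢⇒≡ᵇ-false m n (λ e → m≢n (cong suc e))

<ᵇ-zero : ∀ j → (j <ᵇ 0) ≢ true
<ᵇ-zero zero    ()
<ᵇ-zero (suc j) ()

suc≤ᵇsuc : ∀ j k → (suc j ≤ᵇ suc k) ≡ (j ≤ᵇ k)
suc≤ᵇsuc zero    k = refl
suc≤ᵇsuc (suc j) k = refl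

≤ᵇ-true⇒suc≡ᵇ-false : ∀ j k → (j ≤ᵇ k) ≡ true → (suc k ≡ᵇ j) ≡ false
≤ᵇ-true⇒suc≡ᵇ-false zero    k       e = refl
≤ᵇ-true⇒suc≡ᵇ-false (suc j) (suc k) e = ≤ᵇ-true⇒suc≡ᵇ-false j k (trans (sym (suc≤ᵇsuc j k)) e)

≤ᵇ-true⇒<ᵇsuc : ∀ j k → (j ≤ᵇ k) ≡ true → (j <ᵇ suc k) ≡ true
≤ᵇ-true⇒<ᵇsuc zero    k       e = refl
≤ᵇ-true⇒<ᵇsuc (suc j) (suc k) e = ≤ᵇ-true⇒<ᵇsuc j k (trans (sym (suc≤ᵇsuc j k)) e)

≤ᵇ-true⇒≤ᵇsuc : ∀ c j → (c ≤ᵇ j) ≡ true → (c ≤ᵇ suc j) ≡ true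
≤ᵇ-true⇒≤ᵇsuc zero    j       e = refl
≤ᵇ-true⇒≤ᵇsuc (suc c) (suc j) e =
  trans (suc≤ᵇsuc c (suc j)) (≤ᵇ-true⇒≤ᵇsuc c j (trans (sym (suc≤ᵇsuc c j)) e))

≤ᵇ-false⇒≡ᵇ-false : ∀ j k → (j ≤ᵇ k) ≡ false → (k ≡ᵇ j) ≡ false
≤ᵇ-false⇒≡ᵇ-false (suc j) zero    e = refl
≤ᵇ-false⇒≡ᵇ-false (suc j) (suc k) e = ≤ᵇ-false⇒≡ᵇ-false j k (trans (sym (suc≤ᵇsuc j k)) e)

≤ᵇ-false⇒<ᵇ-false : ∀ j k → (j ≤ᵇ k) ≡ false → (j <ᵇ k) ≡ false
≤ᵇ-false⇒<ᵇ-false (suc j) zero    e = refl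
≤ᵇ-false⇒<ᵇ-false (suc j) (suc k) e = ≤ᵇ-false⇒<ᵇ-false j k (trans (sym (suc≤ᵇsuc j k)) e)

≤ᵇ-false⇒suc≤ᵇ-false : ∀ c j → (c ≤ᵇ j) ≡ false → (suc c ≤ᵇ j) ≡ false
≤ᵇ-false⇒suc≤ᵇ-false (suc c) zero    e = refl
≤ᵇ-false⇒suc≤ᵇ-false (suc c) (suc j) e =
  trans (suc≤ᵇsuc (suc c) j) (≤ᵇ-false⇒suc≤ᵇ-false c j (trans (sym (suc≤ᵇsuc c j)) e))

ext-cong : ∀ {ρ σ : ℕ → ℕ} → (∀ i → ρ i ≡ σ i) → ∀ i → ext ρ i ≡ ext σ i
ext-cong h zero    = refl
ext-cong h (suc i) = cong suc (h i)

ext-id : ∀ {ρ} → (∀ i → ρ i ≡ i) → ∀ i → ext ρ i ≡ i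
ext-id h zero    = refl
ext-id h (suc i) = cong suc (h i)

renQ-cong : ∀ {ρ σ} → (∀ i → ρ i ≡ σ i) → ∀ F → renQ ρ F ≡ renQ σ F
renQ-cong h ✓            = refl
renQ-cong h ⋏            = refl
renQ-cong h (pv b n j a) = cong (pv b n j) (map-cong h a)
renQ-cong h (F ∧ G)      = cong₂ _∧_ (renQ-cong h F) (renQ-cong h G)
renQ-cong h (F ∨ G)      = cong₂ _∨_ (renQ-cong h F) (renQ-cong h G)
renQ-cong h (F ⇒ G)      = cong₂ _⇒_ (renQ-cong h F) (renQ-cong h G)
renQ-cong h (F ⇔ G)      = cong₂ _⇔_ (renQ-cong h F) (renQ-cong h G)
renQ-cong h (∃̇ F)        = cong ∃̇ (renQ-cong (ext-cong h) F)
renQ-cong h (∀̇ F)        = cong ∀̇ (renQ-cong (ext-cong h) F)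

renQ-∘ : ∀ ρ σ F → renQ ρ (renQ σ F) ≡ renQ (λ i → ρ (σ i)) F
renQ-∘ ρ σ ✓            = refl
renQ-∘ ρ σ ⋏            = refl
renQ-∘ ρ σ (pv b n j a) = cong (pv b n j) (sym (map-∘ ρ σ a))
renQ-∘ ρ σ (F ∧ G)      = cong₂ _∧_ (renQ-∘ ρ σ F) (renQ-∘ ρ σ G)
renQ-∘ ρ σ (F ∨ G)      = cong₂ _∨_ (renQ-∘ ρ σ F) (renQ-∘ ρ σ G)
renQ-∘ ρ σ (F ⇒ G)      = cong₂ _⇒_ (renQ-∘ ρ σ F) (renQ-∘ ρ σ G)
renQ-∘ ρ σ (F ⇔ G)      = cong₂ _⇔_ (renQ-∘ ρ σ F) (renQ-∘ ρ σ G)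
renQ-∘ ρ σ (∃̇ F)        =
  cong ∃̇ (trans (renQ-∘ (ext ρ) (ext σ) F) (renQ-cong (λ { zero → refl ; (suc i) → refl }) F))
renQ-∘ ρ σ (∀̇ F)        =
  cong ∀̇ (trans (renQ-∘ (ext ρ) (ext σ) F) (renQ-cong (λ { zero → refl ; (suc i) → refl }) F))

renQ-id : ∀ {ρ} → (∀ i → ρ i ≡ i) → ∀ F → renQ ρ F ≡ F
renQ-id h ✓            = refl
renQ-id h ⋏            = refl
renQ-id h (pv b n j a) = cong (pv b n j) (trans (map-cong h a) (map-id a))
renQ-id h (F ∧ G)      = cong₂ _∧_ (renQ-id h F) (renQ-id h G)
renQ-id h (F ∨ G)      = cong₂ _∨_ (renQ-id h F) (renQ-id h G)
renQ-id h (F ⇒ G)      = cong₂ _⇒_ (renQ-id h F) (renQ-id h G)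
renQ-id h (F ⇔ G)      = cong₂ _⇔_ (renQ-id h F) (renQ-id h G)
renQ-id h (∃̇ F)        = cong ∃̇ (renQ-id (ext-id h) F)
renQ-id h (∀̇ F)        = cong ∀̇ (renQ-id (ext-id h) F)

renQ-inst[] : ∀ F → renQ (inst [] 0) F ≡ F
renQ-inst[] = renQ-id +-identityʳ

renQ-shiftQ : ∀ ρ b n c F → renQ ρ (shiftQ b n c F) ≡ shiftQ b n c (renQ ρ F)
renQ-shiftQ ρ b n c ✓             = refl
renQ-shiftQ ρ b n c ⋏             = refl
renQ-shiftQ ρ b n c (pv b′ n′ j a) = refl
renQ-shiftQ ρ b n c (F ∧ G)       = cong₂ _∧_ (renQ-shiftQ ρ b n c F) (renQ-shiftQ ρ b n c G)
renQ-shiftQ ρ b n c (F ∨ G)       = cong₂ _∨_ (renQ-shiftQ ρ b n c F) (renQ-shiftQ ρ b n c G)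
renQ-shiftQ ρ b n c (F ⇒ G)       = cong₂ _⇒_ (renQ-shiftQ ρ b n c F) (renQ-shiftQ ρ b n c G)
renQ-shiftQ ρ b n c (F ⇔ G)       = cong₂ _⇔_ (renQ-shiftQ ρ b n c F) (renQ-shiftQ ρ b n c G)
renQ-shiftQ ρ b n c (∃̇ F)         = cong ∃̇ (renQ-shiftQ (ext ρ) b n c F)
renQ-shiftQ ρ b n c (∀̇ F)         = cong ∀̇ (renQ-shiftQ (ext ρ) b n c F)

substQ-shiftQ-pv : ∀ b n j G d b′ n′ j′ a →
  substQ b n j G d (shiftQ b n j (pv b′ n′ j′ a)) ≡ pv b′ n′ j′ a
substQ-shiftQ-pv b n j G d b′ n′ j′ a with eqPN b b′ | n ≟ n′
... | false | _ = refl
... | true | no n≢n′ rewrite ≢⇒≡ᵇ-false n n′ n≢n′ = refl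
... | true | yes refl rewrite ≡ᵇ-refl n with j ≤ᵇ j′ in e
...   | true  rewrite ≤ᵇ-true⇒suc≡ᵇ-false j j′ e | ≤ᵇ-true⇒<ᵇsuc j j′ e = refl
...   | false rewrite ≤ᵇ-false⇒≡ᵇ-false j j′ e | ≤ᵇ-false⇒<ᵇ-false j j′ e = refl

module _ (b : PName) (n j : ℕ) (G : QF) where

  substQ-shiftQ : ∀ d F → substQ b n j G d (shiftQ b n j F) ≡ F
  substQ-shiftQ d ✓               = refl
  substQ-shiftQ d ⋏               = refl
  substQ-shiftQ d (pv b′ n′ j′ a) = substQ-shiftQ-pv b n j G d b′ n′ j′ a
  substQ-shiftQ d (F ∧ H) = cong₂ _∧_ (substQ-shiftQ d F) (substQ-shiftQ d H)
  substQ-shiftQ d (F ∨ H) = cong₂ _∨_ (substQ-shiftQ d F) (substQ-shiftQ d H)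
  substQ-shiftQ d (F ⇒ H) = cong₂ _⇒_ (substQ-shiftQ d F) (substQ-shiftQ d H)
  substQ-shiftQ d (F ⇔ H) = cong₂ _⇔_ (substQ-shiftQ d F) (substQ-shiftQ d H)
  substQ-shiftQ d (∃̇ F)   = cong ∃̇ (substQ-shiftQ (suc d) F)
  substQ-shiftQ d (∀̇ F)   = cong ∀̇ (substQ-shiftQ (suc d) F)

shiftQ-shiftQ-pv : ∀ b n c b′ n′ j a →
  shiftQ b n (suc c) (shiftQ b n c (pv b′ n′ j a)) ≡ shiftQ b n c (shiftQ b n c (pv b′ n′ j a))
shiftQ-shiftQ-pv b n c b′ n′ j a with eqPN b b′ | n ≡ᵇ n′
... | false | _     = refl
... | true  | false = refl
... | true  | true with c ≤ᵇ j in e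
...   | true  rewrite suc≤ᵇsuc c j | e | ≤ᵇ-true⇒≤ᵇsuc c j e = refl
...   | false rewrite ≤ᵇ-false⇒suc≤ᵇ-false c j e | e = refl

module _ (b : PName) (n c : ℕ) where

  shiftQ-shiftQ : ∀ F → shiftQ b n (suc c) (shiftQ b n c F) ≡ shiftQ b n c (shiftQ b n c F)
  shiftQ-shiftQ ✓              = refl
  shiftQ-shiftQ ⋏              = refl
  shiftQ-shiftQ (pv b′ n′ j a) = shiftQ-shiftQ-pv b n c b′ n′ j a
  shiftQ-shiftQ (F ∧ H) = cong₂ _∧_ (shiftQ-shiftQ F) (shiftQ-shiftQ H)
  shiftQ-shiftQ (F ∨ H) = cong₂ _∨_ (shiftQ-shiftQ F) (shiftQ-shiftQ H)
  shiftQ-shiftQ (F ⇒ H) = cong₂ _⇒_ (shiftQ-shiftQ F) (shiftQ-shiftQ H)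
  shiftQ-shiftQ (F ⇔ H) = cong₂ _⇔_ (shiftQ-shiftQ F) (shiftQ-shiftQ H)
  shiftQ-shiftQ (∃̇ F)   = cong ∃̇ (shiftQ-shiftQ F)
  shiftQ-shiftQ (∀̇ F)   = cong ∀̇ (shiftQ-shiftQ F)

data Schema : Set where
  var : ℕ → Schema
  _∧ˢ_ _∨ˢ_ _⇒ˢ_ _⇔ˢ_ : Schema → Schema → Schema

⟦_⟧ : Schema → (ℕ → QF) → QF
⟦ var i ⟧   σ = σ i
⟦ π ∧ˢ ρ ⟧ σ = ⟦ π ⟧ σ ∧ ⟦ ρ ⟧ σ
⟦ π ∨ˢ ρ ⟧ σ = ⟦ π ⟧ σ ∨ ⟦ ρ ⟧ σ
⟦ π ⇒ˢ ρ ⟧ σ = ⟦ π ⟧ σ ⇒ ⟦ ρ ⟧ σ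
⟦ π ⇔ˢ ρ ⟧ σ = ⟦ π ⟧ σ ⇔ ⟦ ρ ⟧ σ

⟦⟧-substQ : ∀ b n j G d π σ → substQ b n j G d (⟦ π ⟧ σ) ≡ ⟦ π ⟧ (λ i → substQ b n j G d (σ i))
⟦⟧-substQ b n j G d (var i)  σ = refl
⟦⟧-substQ b n j G d (π ∧ˢ ρ) σ = cong₂ _∧_ (⟦⟧-substQ b n j G d π σ) (⟦⟧-substQ b n j G d ρ σ)
⟦⟧-substQ b n j G d (π ∨ˢ ρ) σ = cong₂ _∨_ (⟦⟧-substQ b n j G d π σ) (⟦⟧-substQ b n j G d ρ σ)
⟦⟧-substQ b n j G d (π ⇒ˢ ρ) σ = cong₂ _⇒_ (⟦⟧-substQ b n j G d π σ) (⟦⟧-substQ b n j G d ρ σ)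
⟦⟧-substQ b n j G d (π ⇔ˢ ρ) σ = cong₂ _⇔_ (⟦⟧-substQ b n j G d π σ) (⟦⟧-substQ b n j G d ρ σ)

⟦⟧-cong : ∀ π {σ τ} → (∀ i → σ i ≡ τ i) → ⟦ π ⟧ σ ≡ ⟦ π ⟧ τ
⟦⟧-cong (var i)  h = h i
⟦⟧-cong (π ∧ˢ ρ) h = cong₂ _∧_ (⟦⟧-cong π h) (⟦⟧-cong ρ h)
⟦⟧-cong (π ∨ˢ ρ) h = cong₂ _∨_ (⟦⟧-cong π h) (⟦⟧-cong ρ h)
⟦⟧-cong (π ⇒ˢ ρ) h = cong₂ _⇒_ (⟦⟧-cong π h) (⟦⟧-cong ρ h)
⟦⟧-cong (π ⇔ˢ ρ) h = cong₂ _⇔_ (⟦⟧-cong π h) (⟦⟧-cong ρ h)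

-- The principles of QH bind the propositional variables r, q, p, in this
-- order, so that inside their bodies r = P 2, q = P 1 and p = P 0.
rqp : QF → QF → QF → ℕ → QF
rqp r q p zero                = p
rqp r q p (suc zero)          = q
rqp r q p (suc (suc zero))    = r
rqp r q p (suc (suc (suc k))) = QHAx.P k

substQ-rqp : ∀ r q p i →
  substQ prob 0 0 p 0 (substQ prob 0 1 (shiftQ prob 0 0 q) 0
    (substQ prob 0 2 (shiftQ prob 0 0 (shiftQ prob 0 0 r)) 0 (QHAx.P i)))
  ≡ rqp r q p i
substQ-rqp r q p zero = renQ-inst[] p
substQ-rqp r q p (suc zero) rewrite renQ-inst[] (shiftQ prob 0 0 q) = substQ-shiftQ prob 0 0 p 0 q
substQ-rqp r q p (suc (suc zero))
  rewrite renQ-inst[] (shiftQ prob 0 0 (shiftQ prob 0 0 r))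
        | sym (shiftQ-shiftQ prob 0 0 r)
        | substQ-shiftQ prob 0 1 (shiftQ prob 0 0 q) 0 (shiftQ prob 0 0 r)
  = substQ-shiftQ prob 0 0 p 0 r
substQ-rqp r q p (suc (suc (suc k))) = refl

∀²E-rqp : ∀ {Δ} π → ND Δ (QHAx.pr3 (⟦ π ⟧ QHAx.P)) → ∀ r q p → ND Δ (atom (⟦ π ⟧ (rqp r q p)))
∀²E-rqp {Δ} π D r q p =
  subst (λ X → ND Δ (atom X))
    (trans (⟦⟧-substQ prob 0 0 p 0 π _) (⟦⟧-cong π (substQ-rqp r q p)))
    (∀²E (subst (λ X → ND Δ (∀² QHAx.k0 (atom X))) (⟦⟧-substQ prob 0 1 (shiftQ prob 0 0 q) 0 π _)
      (∀²E (subst (λ X → ND Δ (∀² QHAx.k0 (∀² QHAx.k0 (atom X)))) (⟦⟧-substQ prob 0 2 _ 0 π _)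
        (∀²E D r)) q)) p)

conjunct : ℕ → MF → MF
conjunct _       (atom F) = atom F
conjunct zero    (M & N)  = M
conjunct (suc i) (M & N)  = conjunct i N
conjunct _       (M ⟹ N) = M ⟹ N
conjunct _       (∀¹ M)   = ∀¹ M
conjunct _       (∀² k M) = ∀² k M

&E-conjunct : ∀ {Δ} i {M} → ND Δ M → ND Δ (conjunct i M)
&E-conjunct _       {atom F} D = D
&E-conjunct zero    {M & N}  D = &E₁ D
&E-conjunct (suc i) {M & N}  D = &E-conjunct i (&E₂ D)
&E-conjunct _       {M ⟹ N} D = D
&E-conjunct _       {∀¹ M}   D = D
&E-conjunct _       {∀² k M} D = D

stab : QF → QF
stab X = ¬¬ X ⇒ X

module QHProofs {Δ : List MF} (hasQH : 𝒟QH ∈ Δ) where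

  Prov : QF → Set
  Prov X = ND Δ (atom X)

  axiom : ∀ i → ND Δ (conjunct i 𝒟QH)
  axiom i = &E-conjunct i (hyp hasQH)

  private
    r q p : Schema
    r = var 2
    q = var 1
    p = var 0

  axK : ∀ A B → Prov (A ⇒ (B ⇒ A))
  axK A B = ∀²E-rqp (r ⇒ˢ (q ⇒ˢ r)) (axiom 0) A B ✓
  axS : ∀ A B Z → Prov ((A ⇒ (B ⇒ Z)) ⇒ ((A ⇒ B) ⇒ (A ⇒ Z)))
  axS A B Z = ∀²E-rqp ((r ⇒ˢ (q ⇒ˢ p)) ⇒ˢ ((r ⇒ˢ q) ⇒ˢ (r ⇒ˢ p))) (axiom 1) A B Z
  ax∧₁ : ∀ A B → Prov ((A ∧ B) ⇒ A)
  ax∧₁ A B = ∀²E-rqp ((r ∧ˢ q) ⇒ˢ r) (axiom 2) A B ✓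
  ax∧₂ : ∀ A B → Prov ((A ∧ B) ⇒ B)
  ax∧₂ A B = ∀²E-rqp ((r ∧ˢ q) ⇒ˢ q) (axiom 3) A B ✓
  ax∧I : ∀ A B → Prov (A ⇒ (B ⇒ (A ∧ B)))
  ax∧I A B = ∀²E-rqp (r ⇒ˢ (q ⇒ˢ (r ∧ˢ q))) (axiom 4) A B ✓
  ax∨₁ : ∀ A B → Prov (A ⇒ (A ∨ B))
  ax∨₁ A B = ∀²E-rqp (r ⇒ˢ (r ∨ˢ q)) (axiom 5) A B ✓
  ax∨₂ : ∀ A B → Prov (B ⇒ (A ∨ B))
  ax∨₂ A B = ∀²E-rqp (q ⇒ˢ (r ∨ˢ q)) (axiom 6) A B ✓
  ax∨E : ∀ A B Z → Prov ((A ⇒ Z) ⇒ ((B ⇒ Z) ⇒ ((A ∨ B) ⇒ Z)))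
  ax∨E A B Z = ∀²E-rqp ((r ⇒ˢ p) ⇒ˢ ((q ⇒ˢ p) ⇒ˢ ((r ∨ˢ q) ⇒ˢ p))) (axiom 7) A B Z
  ax⇔₁ : ∀ A B → Prov ((A ⇔ B) ⇒ (A ⇒ B))
  ax⇔₁ A B = ∀²E-rqp ((q ⇔ˢ p) ⇒ˢ (q ⇒ˢ p)) (axiom 8) ✓ A B
  ax⇔₂ : ∀ A B → Prov ((A ⇔ B) ⇒ (B ⇒ A))
  ax⇔₂ A B = ∀²E-rqp ((q ⇔ˢ p) ⇒ˢ (p ⇒ˢ q)) (axiom 9) ✓ A B
  ax⇔I : ∀ A B → Prov ((A ⇒ B) ⇒ ((B ⇒ A) ⇒ (A ⇔ B)))
  ax⇔I A B = ∀²E-rqp ((q ⇒ˢ p) ⇒ˢ ((p ⇒ˢ q) ⇒ˢ (q ⇔ˢ p))) (axiom 10) ✓ A B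

  ax✓ : Prov ✓
  ax✓ = axiom 13

  ax⋏ : ∀ A → Prov (⋏ ⇒ A)
  ax⋏ A = subst (λ X → Prov (⋏ ⇒ X)) (renQ-inst[] A) (∀²E (axiom 14) A)

  mp : ∀ {A B} → Prov A → Prov (A ⇒ B) → Prov B
  mp {A} {B} a ab =
    ⟹E (subst (λ X → ND Δ (atom X & atom (X ⇒ B) ⟹ atom B)) A′≡A
          (subst (λ Y → ND Δ (atom A′ & atom (A′ ⇒ Y) ⟹ atom Y)) (renQ-inst[] B)
            (∀²E (∀²E (axiom 15) A) B)))
       (&I a ab)
    where
    A′ : QF
    A′ = substQ prob 0 0 B 0 (renQ (inst [] 0) (shiftQ prob 0 0 A))
    A′≡A : A′ ≡ A
    A′≡A rewrite renQ-inst[] (shiftQ prob 0 0 A) = substQ-shiftQ prob 0 0 B 0 A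

  axI : ∀ A → Prov (A ⇒ A)
  axI A = mp (axK A A) (mp (axK A (A ⇒ A)) (axS A (A ⇒ A) A))

  -- Natural deduction with object-level hypotheses, compiled into
  -- Hilbert-style derivations by the deduction theorem.
  data Der : List QF → QF → Set where
    #0  : ∀ {Γ A} → Der (A ∷ Γ) A
    wk  : ∀ {Γ A X} → Der Γ X → Der (A ∷ Γ) X
    lam : ∀ {Γ A B} → Der (A ∷ Γ) B → Der Γ (A ⇒ B)
    app : ∀ {Γ A B} → Der Γ (A ⇒ B) → Der Γ A → Der Γ B
    thm : ∀ {Γ X} → Prov X → Der Γ X

  closure : List QF → QF → QF
  closure []      X = X
  closure (A ∷ Γ) X = closure Γ (A ⇒ X)

  const-closure : ∀ Γ {X} → Prov X → Prov (closure Γ X)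
  const-closure []      t = t
  const-closure (A ∷ Γ) {X} t = const-closure Γ (mp t (axK X A))

  app-closure : ∀ Γ {A B} → Prov (closure Γ (A ⇒ B)) → Prov (closure Γ A) → Prov (closure Γ B)
  app-closure []      f a = mp a f
  app-closure (Z ∷ Γ) {A} {B} f a =
    app-closure Γ (app-closure Γ (const-closure Γ (axS Z A B)) f) a

  deduction : ∀ {Γ X} → Der Γ X → Prov (closure Γ X)
  deduction {A ∷ Γ}     #0        = const-closure Γ (axI _)
  deduction {A ∷ Γ} {X} (wk d)    = app-closure Γ (const-closure Γ (axK X A)) (deduction d)
  deduction             (lam d)   = deduction d
  deduction {Γ}         (app f a) = app-closure Γ (deduction f) (deduction a)
  deduction {Γ}         (thm t)   = const-closure Γ t

  run : ∀ {X} → Der [] X → Prov X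
  run = deduction

  #1 : ∀ {Γ A B} → Der (B ∷ A ∷ Γ) A
  #1 = wk #0
  #2 : ∀ {Γ A B Z} → Der (Z ∷ B ∷ A ∷ Γ) A
  #2 = wk #1
  #3 : ∀ {Γ A B Z D} → Der (D ∷ Z ∷ B ∷ A ∷ Γ) A
  #3 = wk #2
  #4 : ∀ {Γ A B Z D E} → Der (E ∷ D ∷ Z ∷ B ∷ A ∷ Γ) A
  #4 = wk #3

  ∧i : ∀ {Γ A B} → Der Γ A → Der Γ B → Der Γ (A ∧ B)
  ∧i a b = app (app (thm (ax∧I _ _)) a) b
  ∧e₁ : ∀ {Γ A B} → Der Γ (A ∧ B) → Der Γ A
  ∧e₁ d = app (thm (ax∧₁ _ _)) d
  ∧e₂ : ∀ {Γ A B} → Der Γ (A ∧ B) → Der Γ B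
  ∧e₂ d = app (thm (ax∧₂ _ _)) d
  ∨i₁ : ∀ {Γ A B} → Der Γ A → Der Γ (A ∨ B)
  ∨i₁ d = app (thm (ax∨₁ _ _)) d
  ∨i₂ : ∀ {Γ A B} → Der Γ B → Der Γ (A ∨ B)
  ∨i₂ d = app (thm (ax∨₂ _ _)) d
  ∨e : ∀ {Γ A B Z} → Der Γ (A ∨ B) → Der (A ∷ Γ) Z → Der (B ∷ Γ) Z → Der Γ Z
  ∨e d l r = app (app (app (thm (ax∨E _ _ _)) (lam l)) (lam r)) d
  ⇔i : ∀ {Γ A B} → Der Γ (A ⇒ B) → Der Γ (B ⇒ A) → Der Γ (A ⇔ B)
  ⇔i a b = app (app (thm (ax⇔I _ _)) a) b

  -- The quantifier principles are stated for a unary variable θ, so they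
  -- are instantiated by formulas whose argument place is variable 0.
  ax∀E : ∀ B t → Prov (∀̇ B ⇒ renQ (sub0 t) B)
  ax∀E B t = subst (ND Δ) eq (∀¹E (∀²E (axiom 11) B) t)
    where
    eq : atom (∀̇ (renQ (ext (sub0 t)) (renQ (inst (0 ∷ []) 1) (renQ (ext suc) B)))
               ⇒ renQ (sub0 t) (renQ (inst (0 ∷ []) 0) (renQ (ext suc) B)))
         ≡ atom (∀̇ B ⇒ renQ (sub0 t) B)
    eq = cong₂ (λ X Y → atom (∀̇ X ⇒ Y))
      (trans (renQ-∘ _ _ _) (trans (renQ-∘ _ _ B)
        (renQ-id (λ { zero → refl ; (suc k) → cong suc (cong (sub0 t) (+-comm k 1)) }) B)))
      (trans (renQ-∘ _ _ _) (trans (renQ-∘ _ _ B)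
        (renQ-cong (λ { zero → refl ; (suc k) → +-identityʳ k }) B)))

  ax∃I : ∀ B t → Prov (renQ (sub0 t) B ⇒ ∃̇ B)
  ax∃I B t = subst (ND Δ) eq (∀¹E (∀²E (axiom 12) B) t)
    where
    eq : atom (renQ (sub0 t) (renQ (inst (0 ∷ []) 0) (renQ (ext suc) B))
               ⇒ ∃̇ (renQ (ext (sub0 t)) (renQ (inst (0 ∷ []) 1) (renQ (ext suc) B))))
         ≡ atom (renQ (sub0 t) B ⇒ ∃̇ B)
    eq = cong₂ (λ Y X → atom (Y ⇒ ∃̇ X))
      (trans (renQ-∘ _ _ _) (trans (renQ-∘ _ _ B)
        (renQ-cong (λ { zero → refl ; (suc k) → +-identityʳ k }) B)))
      (trans (renQ-∘ _ _ _) (trans (renQ-∘ _ _ B)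
        (renQ-id (λ { zero → refl ; (suc k) → cong suc (cong (sub0 t) (+-comm k 1)) }) B)))

  private
    weakened-p : ∀ A B → substQ prob 1 0 B 0 (renQ (inst [] 0) (renQ suc (shiftQ prob 1 0 A))) ≡ renQ suc A
    weakened-p A B rewrite renQ-inst[] (renQ suc (shiftQ prob 1 0 A)) | renQ-shiftQ suc prob 1 0 A =
      substQ-shiftQ prob 1 0 B 0 (renQ suc A)
    plain-p : ∀ A B → substQ prob 1 0 B 0 (renQ (inst [] 0) (shiftQ prob 1 0 A)) ≡ A
    plain-p A B rewrite renQ-inst[] (shiftQ prob 1 0 A) = substQ-shiftQ prob 1 0 B 0 A
    θ-at-0 : ∀ B → renQ (inst (0 ∷ []) 0) (renQ (ext suc) B) ≡ B
    θ-at-0 B = trans (renQ-∘ _ _ B) (renQ-id (λ { zero → refl ; (suc k) → cong suc (+-identityʳ k) }) B)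
    θ-under-binder : ∀ B → renQ (inst (0 ∷ []) 1) B ≡ B
    θ-under-binder B = renQ-id (λ { zero → refl ; (suc k) → +-comm k 1 }) B

  rule∀I : ∀ A B → ND (map (mrenI suc) Δ) (atom (renQ suc A ⇒ B)) → Prov (A ⇒ ∀̇ B)
  rule∀I A B d = ⟹E (subst (ND Δ) eq (∀²E (∀²E (axiom 16) A) B)) (∀¹I d)
    where
    eq = cong₂ (λ X Y → ∀¹ (atom X) ⟹ atom Y)
           (cong₂ _⇒_ (weakened-p A (renQ (ext suc) B)) (θ-at-0 B))
           (cong₂ (λ a b → a ⇒ ∀̇ b) (plain-p A B) (θ-under-binder B))

  rule∃E : ∀ A B → ND (map (mrenI suc) Δ) (atom (B ⇒ renQ suc A)) → Prov (∃̇ B ⇒ A)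
  rule∃E A B d = ⟹E (subst (ND Δ) eq (∀²E (∀²E (axiom 17) A) B)) (∀¹I d)
    where
    eq = cong₂ (λ X Y → ∀¹ (atom X) ⟹ atom Y)
           (cong₂ _⇒_ (θ-at-0 B) (weakened-p A (renQ (ext suc) B)))
           (cong₂ (λ b a → ∃̇ b ⇒ a) (θ-under-binder B) (plain-p A B))

  dni : ∀ {Γ A} → Der Γ A → Der Γ (¬¬ A)
  dni d = lam (app #0 (wk d))

  stab-¬¬ : ∀ X → Prov (stab (¬¬ X))
  stab-¬¬ X = run (lam (lam (app #1 (lam (app #0 #1)))))

  ¬¬-mp : ∀ A B → Prov (¬¬ (A ⇒ B) ⇒ (¬¬ A ⇒ ¬¬ B))
  ¬¬-mp A B = run (lam (lam (lam (app #2 (lam (app #2 (lam (app #2 (app #1 #0)))))))))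

  ¬¬-bind : ∀ A B → Prov (¬¬ A ⇒ ((A ⇒ ¬¬ B) ⇒ ¬¬ B))
  ¬¬-bind A B = run (lam (lam (lam (app #2 (lam (app (app #2 #0) #1))))))

  dnApp : ∀ {Γ A B} → Der Γ (¬¬ (A ⇒ B)) → Der Γ (¬¬ A) → Der Γ (¬¬ B)
  dnApp f a = app (app (thm (¬¬-mp _ _)) f) a

  dnMap : ∀ {Γ A B} → Prov (A ⇒ B) → Der Γ (¬¬ A) → Der Γ (¬¬ B)
  dnMap f d = dnApp (dni (thm f)) d

  dnBind : ∀ {Γ A B} → Der Γ (¬¬ A) → Der (A ∷ Γ) (¬¬ B) → Der Γ (¬¬ B)
  dnBind a d = app (app (thm (¬¬-bind _ _)) a) (lam d)

  dnE : ∀ {Γ X} → Prov (stab X) → Der Γ (¬¬ X) → Der Γ X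
  dnE s d = app (thm s) d

  dnImpE : ∀ {Γ A B} → Prov (stab B) → Der Γ (¬¬ (A ⇒ B)) → Der Γ A → Der Γ B
  dnImpE s f a = dnE s (dnApp f (dni a))

-- S n j ≡ true when the proper variable of arity n and index j is bound by a
-- meta-quantifier; it is then translated as p̂ rather than ¬¬p̂.
Stability : Set
Stability = ℕ → ℕ → Bool

dnUnless : Bool → QF → QF
dnUnless true X = X
dnUnless false X = ¬¬ X

trWith : Stability → ∀ {s} → Fm s → QF
trWith S ⊤ = ✓
trWith S ⊥ = ⋏
trWith S ✓ = ✓
trWith S ⋏ = ⋏
trWith S (pv {I} n j a) = pv prob n j a
trWith S (pv {C} n j a) = dnUnless (S n j) (pv hat n j a)
trWith S (¿ Φ) = ¬¬ trWith S Φ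
trWith S (¡ F) = trWith S F
trWith S (_∧_ {I} F G) = trWith S F ∧ trWith S G
trWith S (_∨_ {I} F G) = trWith S F ∨ trWith S G
trWith S (_⇒_ {I} F G) = trWith S F ⇒ trWith S G
trWith S (_⇔_ {I} F G) = trWith S F ⇔ trWith S G
trWith S (_∧_ {C} F G) = ¬¬ (trWith S F ∧ trWith S G)
trWith S (_∨_ {C} F G) = ¬¬ (trWith S F ∨ trWith S G)
trWith S (_⇒_ {C} F G) = ¬¬ (trWith S F ⇒ trWith S G)
trWith S (_⇔_ {C} F G) = ¬¬ (trWith S F ⇔ trWith S G)
trWith S (¬ᶜ F) = ¬¬ (¬ trWith S F)
trWith S (∃̇ {I} F) = ∃̇ (trWith S F)
trWith S (∀̇ {I} F) = ∀̇ (trWith S F)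
trWith S (∃̇ {C} F) = ¬¬ ∃̇ (trWith S F)
trWith S (∀̇ {C} F) = ¬¬ ∀̇ (trWith S F)

unstable : Stability
unstable _ _ = false

trWith-unstable : ∀ {s} (F : Fm s) → trWith unstable F ≡ tr F
trWith-unstable ⊤ = refl
trWith-unstable ⊥ = refl
trWith-unstable ✓ = refl
trWith-unstable ⋏ = refl
trWith-unstable (pv {I} n j a) = refl
trWith-unstable (pv {C} n j a) = refl
trWith-unstable (¿ Φ) = cong ¬¬_ (trWith-unstable Φ)
trWith-unstable (¡ F) = trWith-unstable F
trWith-unstable (_∧_ {I} F G) = cong₂ _∧_ (trWith-unstable F) (trWith-unstable G)
trWith-unstable (_∨_ {I} F G) = cong₂ _∨_ (trWith-unstable F) (trWith-unstable G)
trWith-unstable (_⇒_ {I} F G) = cong₂ _⇒_ (trWith-unstable F) (trWith-unstable G)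
trWith-unstable (_⇔_ {I} F G) = cong₂ _⇔_ (trWith-unstable F) (trWith-unstable G)
trWith-unstable (_∧_ {C} F G) = cong ¬¬_ (cong₂ _∧_ (trWith-unstable F) (trWith-unstable G))
trWith-unstable (_∨_ {C} F G) = cong ¬¬_ (cong₂ _∨_ (trWith-unstable F) (trWith-unstable G))
trWith-unstable (_⇒_ {C} F G) = cong ¬¬_ (cong₂ _⇒_ (trWith-unstable F) (trWith-unstable G))
trWith-unstable (_⇔_ {C} F G) = cong ¬¬_ (cong₂ _⇔_ (trWith-unstable F) (trWith-unstable G))
trWith-unstable (¬ᶜ F) = cong (λ X → ¬¬ (¬ X)) (trWith-unstable F)
trWith-unstable (∃̇ {I} F) = cong ∃̇ (trWith-unstable F)
trWith-unstable (∀̇ {I} F) = cong ∀̇ (trWith-unstable F)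
trWith-unstable (∃̇ {C} F) = cong (λ X → ¬¬ ∃̇ X) (trWith-unstable F)
trWith-unstable (∀̇ {C} F) = cong (λ X → ¬¬ ∀̇ X) (trWith-unstable F)

-- S′ is S after shifting the arity-n indices ≥ c, resp. S is S′ after
-- substituting for the (stable) arity-n variable j.
ShiftsTo : Stability → Stability → ℕ → ℕ → Set
ShiftsTo S S′ n c = ∀ m j → S′ m (if (n ≡ᵇ m) and (c ≤ᵇ j) then suc j else j) ≡ S m j

record SubstsTo (S S′ : Stability) (n j : ℕ) : Set where
  field
    hit   : ∀ j′ → (j′ ≡ᵇ j) ≡ true → S′ n j′ ≡ true
    miss  : ∀ j′ → (j′ ≡ᵇ j) ≡ false → S′ n j′ ≡ S n (if j <ᵇ j′ then pred j′ else j′)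
    other : ∀ m j′ → n ≢ m → S′ m j′ ≡ S m j′

dnUnless-renQ : ∀ b ρ X → renQ ρ (dnUnless b X) ≡ dnUnless b (renQ ρ X)
dnUnless-renQ true ρ X = refl
dnUnless-renQ false ρ X = refl

module _ (S : Stability) where

  trWith-renF : ∀ ρ {s} (F : Fm s) → trWith S (renF ρ F) ≡ renQ ρ (trWith S F)
  trWith-renF ρ ⊤ = refl
  trWith-renF ρ ⊥ = refl
  trWith-renF ρ ✓ = refl
  trWith-renF ρ ⋏ = refl
  trWith-renF ρ (pv {I} n j a) = refl
  trWith-renF ρ (pv {C} n j a) = sym (dnUnless-renQ (S n j) ρ _)
  trWith-renF ρ (¿ Φ) = cong ¬¬_ (trWith-renF ρ Φ)
  trWith-renF ρ (¡ F) = trWith-renF ρ F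
  trWith-renF ρ (_∧_ {I} F G) = cong₂ _∧_ (trWith-renF ρ F) (trWith-renF ρ G)
  trWith-renF ρ (_∨_ {I} F G) = cong₂ _∨_ (trWith-renF ρ F) (trWith-renF ρ G)
  trWith-renF ρ (_⇒_ {I} F G) = cong₂ _⇒_ (trWith-renF ρ F) (trWith-renF ρ G)
  trWith-renF ρ (_⇔_ {I} F G) = cong₂ _⇔_ (trWith-renF ρ F) (trWith-renF ρ G)
  trWith-renF ρ (_∧_ {C} F G) = cong ¬¬_ (cong₂ _∧_ (trWith-renF ρ F) (trWith-renF ρ G))
  trWith-renF ρ (_∨_ {C} F G) = cong ¬¬_ (cong₂ _∨_ (trWith-renF ρ F) (trWith-renF ρ G))
  trWith-renF ρ (_⇒_ {C} F G) = cong ¬¬_ (cong₂ _⇒_ (trWith-renF ρ F) (trWith-renF ρ G))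
  trWith-renF ρ (_⇔_ {C} F G) = cong ¬¬_ (cong₂ _⇔_ (trWith-renF ρ F) (trWith-renF ρ G))
  trWith-renF ρ (¬ᶜ F) = cong (λ X → ¬¬ (¬ X)) (trWith-renF ρ F)
  trWith-renF ρ (∃̇ {I} F) = cong ∃̇ (trWith-renF (ext ρ) F)
  trWith-renF ρ (∀̇ {I} F) = cong ∀̇ (trWith-renF (ext ρ) F)
  trWith-renF ρ (∃̇ {C} F) = cong (λ X → ¬¬ ∃̇ X) (trWith-renF (ext ρ) F)
  trWith-renF ρ (∀̇ {C} F) = cong (λ X → ¬¬ ∀̇ X) (trWith-renF (ext ρ) F)

dnUnless-shiftQ : ∀ b′ b n c X → shiftQ b n c (dnUnless b′ X) ≡ dnUnless b′ (shiftQ b n c X)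
dnUnless-shiftQ true b n c X = refl
dnUnless-shiftQ false b n c X = refl

module _ (S S′ : Stability) (n c : ℕ) (h : ShiftsTo S S′ n c) where

  trWith-shiftF-C : ∀ {s} (F : Fm s) → trWith S′ (shiftF C n c F) ≡ shiftQ hat n c (trWith S F)
  trWith-shiftF-C ⊤ = refl
  trWith-shiftF-C ⊥ = refl
  trWith-shiftF-C ✓ = refl
  trWith-shiftF-C ⋏ = refl
  trWith-shiftF-C (pv {I} m j a) = refl
  trWith-shiftF-C (pv {C} m j a) = trans (cong (λ b → dnUnless b _) (h m j)) (sym (dnUnless-shiftQ (S m j) hat n c _))
  trWith-shiftF-C (¿ Φ) = cong ¬¬_ (trWith-shiftF-C Φ)
  trWith-shiftF-C (¡ F) = trWith-shiftF-C F
  trWith-shiftF-C (_∧_ {I} F G) = cong₂ _∧_ (trWith-shiftF-C F) (trWith-shiftF-C G)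
  trWith-shiftF-C (_∨_ {I} F G) = cong₂ _∨_ (trWith-shiftF-C F) (trWith-shiftF-C G)
  trWith-shiftF-C (_⇒_ {I} F G) = cong₂ _⇒_ (trWith-shiftF-C F) (trWith-shiftF-C G)
  trWith-shiftF-C (_⇔_ {I} F G) = cong₂ _⇔_ (trWith-shiftF-C F) (trWith-shiftF-C G)
  trWith-shiftF-C (_∧_ {C} F G) = cong ¬¬_ (cong₂ _∧_ (trWith-shiftF-C F) (trWith-shiftF-C G))
  trWith-shiftF-C (_∨_ {C} F G) = cong ¬¬_ (cong₂ _∨_ (trWith-shiftF-C F) (trWith-shiftF-C G))
  trWith-shiftF-C (_⇒_ {C} F G) = cong ¬¬_ (cong₂ _⇒_ (trWith-shiftF-C F) (trWith-shiftF-C G))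
  trWith-shiftF-C (_⇔_ {C} F G) = cong ¬¬_ (cong₂ _⇔_ (trWith-shiftF-C F) (trWith-shiftF-C G))
  trWith-shiftF-C (¬ᶜ F) = cong (λ X → ¬¬ (¬ X)) (trWith-shiftF-C F)
  trWith-shiftF-C (∃̇ {I} F) = cong ∃̇ (trWith-shiftF-C F)
  trWith-shiftF-C (∀̇ {I} F) = cong ∀̇ (trWith-shiftF-C F)
  trWith-shiftF-C (∃̇ {C} F) = cong (λ X → ¬¬ ∃̇ X) (trWith-shiftF-C F)
  trWith-shiftF-C (∀̇ {C} F) = cong (λ X → ¬¬ ∀̇ X) (trWith-shiftF-C F)

module _ (S : Stability) (n c : ℕ) where

  trWith-shiftF-I : ∀ {s} (F : Fm s) → trWith S (shiftF I n c F) ≡ shiftQ prob n c (trWith S F)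
  trWith-shiftF-I ⊤ = refl
  trWith-shiftF-I ⊥ = refl
  trWith-shiftF-I ✓ = refl
  trWith-shiftF-I ⋏ = refl
  trWith-shiftF-I (pv {I} m j a) = refl
  trWith-shiftF-I (pv {C} m j a) = sym (dnUnless-shiftQ (S m j) prob n c _)
  trWith-shiftF-I (¿ Φ) = cong ¬¬_ (trWith-shiftF-I Φ)
  trWith-shiftF-I (¡ F) = trWith-shiftF-I F
  trWith-shiftF-I (_∧_ {I} F G) = cong₂ _∧_ (trWith-shiftF-I F) (trWith-shiftF-I G)
  trWith-shiftF-I (_∨_ {I} F G) = cong₂ _∨_ (trWith-shiftF-I F) (trWith-shiftF-I G)
  trWith-shiftF-I (_⇒_ {I} F G) = cong₂ _⇒_ (trWith-shiftF-I F) (trWith-shiftF-I G)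
  trWith-shiftF-I (_⇔_ {I} F G) = cong₂ _⇔_ (trWith-shiftF-I F) (trWith-shiftF-I G)
  trWith-shiftF-I (_∧_ {C} F G) = cong ¬¬_ (cong₂ _∧_ (trWith-shiftF-I F) (trWith-shiftF-I G))
  trWith-shiftF-I (_∨_ {C} F G) = cong ¬¬_ (cong₂ _∨_ (trWith-shiftF-I F) (trWith-shiftF-I G))
  trWith-shiftF-I (_⇒_ {C} F G) = cong ¬¬_ (cong₂ _⇒_ (trWith-shiftF-I F) (trWith-shiftF-I G))
  trWith-shiftF-I (_⇔_ {C} F G) = cong ¬¬_ (cong₂ _⇔_ (trWith-shiftF-I F) (trWith-shiftF-I G))
  trWith-shiftF-I (¬ᶜ F) = cong (λ X → ¬¬ (¬ X)) (trWith-shiftF-I F)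
  trWith-shiftF-I (∃̇ {I} F) = cong ∃̇ (trWith-shiftF-I F)
  trWith-shiftF-I (∀̇ {I} F) = cong ∀̇ (trWith-shiftF-I F)
  trWith-shiftF-I (∃̇ {C} F) = cong (λ X → ¬¬ ∃̇ X) (trWith-shiftF-I F)
  trWith-shiftF-I (∀̇ {C} F) = cong (λ X → ¬¬ ∀̇ X) (trWith-shiftF-I F)

dnUnless-substQ : ∀ b′ b n j G d X → substQ b n j G d (dnUnless b′ X) ≡ dnUnless b′ (substQ b n j G d X)
dnUnless-substQ true b n j G d X = refl
dnUnless-substQ false b n j G d X = refl

trWith-substAt-C : ∀ (S S′ : Stability) n j G d → SubstsTo S S′ n j →
  ∀ m j′ a →
  trWith S (substAt C n j G d C m j′ a) ≡ dnUnless (S′ m j′) (substQAt hat n j (trWith S G) d hat m j′ a)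
trWith-substAt-C S S′ n j G d ok m j′ a with n ≟ m
... | no ne = cong (λ b → dnUnless b _) (sym (SubstsTo.other ok m j′ ne))
... | yes refl with j′ ≡ᵇ j in e
...   | true rewrite SubstsTo.hit ok j′ e = trWith-renF S (inst a d) G
...   | false rewrite SubstsTo.miss ok j′ e with j <ᵇ j′
...     | true = refl
...     | false = refl

module _ (S S′ : Stability) (n j : ℕ) (G₀ : Fm C) (ok : SubstsTo S S′ n j) where

  trWith-substF-C : ∀ d {s} (F : Fm s) →
      trWith S (substF C n j G₀ d F) ≡ substQ hat n j (trWith S G₀) d (trWith S′ F)
  trWith-substF-C d ⊤ = refl
  trWith-substF-C d ⊥ = refl
  trWith-substF-C d ✓ = refl
  trWith-substF-C d ⋏ = refl
  trWith-substF-C d (pv {I} m j′ a) = refl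
  trWith-substF-C d (pv {C} m j′ a) =
    trans (trWith-substAt-C S S′ n j G₀ d ok m j′ a) (sym (dnUnless-substQ (S′ m j′) hat n j _ d _))
  trWith-substF-C d (¿ Φ) = cong ¬¬_ (trWith-substF-C d Φ)
  trWith-substF-C d (¡ F) = trWith-substF-C d F
  trWith-substF-C d (_∧_ {I} F G) = cong₂ _∧_ (trWith-substF-C d F) (trWith-substF-C d G)
  trWith-substF-C d (_∨_ {I} F G) = cong₂ _∨_ (trWith-substF-C d F) (trWith-substF-C d G)
  trWith-substF-C d (_⇒_ {I} F G) = cong₂ _⇒_ (trWith-substF-C d F) (trWith-substF-C d G)
  trWith-substF-C d (_⇔_ {I} F G) = cong₂ _⇔_ (trWith-substF-C d F) (trWith-substF-C d G)
  trWith-substF-C d (_∧_ {C} F G) = cong ¬¬_ (cong₂ _∧_ (trWith-substF-C d F) (trWith-substF-C d G))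
  trWith-substF-C d (_∨_ {C} F G) = cong ¬¬_ (cong₂ _∨_ (trWith-substF-C d F) (trWith-substF-C d G))
  trWith-substF-C d (_⇒_ {C} F G) = cong ¬¬_ (cong₂ _⇒_ (trWith-substF-C d F) (trWith-substF-C d G))
  trWith-substF-C d (_⇔_ {C} F G) = cong ¬¬_ (cong₂ _⇔_ (trWith-substF-C d F) (trWith-substF-C d G))
  trWith-substF-C d (¬ᶜ F) = cong (λ X → ¬¬ (¬ X)) (trWith-substF-C d F)
  trWith-substF-C d (∃̇ {I} F) = cong ∃̇ (trWith-substF-C (suc d) F)
  trWith-substF-C d (∀̇ {I} F) = cong ∀̇ (trWith-substF-C (suc d) F)
  trWith-substF-C d (∃̇ {C} F) = cong (λ X → ¬¬ ∃̇ X) (trWith-substF-C (suc d) F)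
  trWith-substF-C d (∀̇ {C} F) = cong (λ X → ¬¬ ∀̇ X) (trWith-substF-C (suc d) F)

trWith-substAt-I : ∀ S n j G d m j′ a →
  trWith S (substAt I n j G d I m j′ a) ≡ substQAt prob n j (trWith S G) d prob m j′ a
trWith-substAt-I S n j G d m j′ a with n ≟ m
... | no ne = refl
... | yes refl with j′ ≡ᵇ j
...   | true = trWith-renF S (inst a d) G
...   | false with j <ᵇ j′
...     | true = refl
...     | false = refl

module _ (S : Stability) (n j : ℕ) (G₀ : Fm I) where

  trWith-substF-I : ∀ d {s} (F : Fm s) →
      trWith S (substF I n j G₀ d F) ≡ substQ prob n j (trWith S G₀) d (trWith S F)
  trWith-substF-I d ⊤ = refl
  trWith-substF-I d ⊥ = refl
  trWith-substF-I d ✓ = refl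
  trWith-substF-I d ⋏ = refl
  trWith-substF-I d (pv {I} m j′ a) = trWith-substAt-I S n j G₀ d m j′ a
  trWith-substF-I d (pv {C} m j′ a) = sym (dnUnless-substQ (S m j′) prob n j _ d _)
  trWith-substF-I d (¿ Φ) = cong ¬¬_ (trWith-substF-I d Φ)
  trWith-substF-I d (¡ F) = trWith-substF-I d F
  trWith-substF-I d (_∧_ {I} F G) = cong₂ _∧_ (trWith-substF-I d F) (trWith-substF-I d G)
  trWith-substF-I d (_∨_ {I} F G) = cong₂ _∨_ (trWith-substF-I d F) (trWith-substF-I d G)
  trWith-substF-I d (_⇒_ {I} F G) = cong₂ _⇒_ (trWith-substF-I d F) (trWith-substF-I d G)
  trWith-substF-I d (_⇔_ {I} F G) = cong₂ _⇔_ (trWith-substF-I d F) (trWith-substF-I d G)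
  trWith-substF-I d (_∧_ {C} F G) = cong ¬¬_ (cong₂ _∧_ (trWith-substF-I d F) (trWith-substF-I d G))
  trWith-substF-I d (_∨_ {C} F G) = cong ¬¬_ (cong₂ _∨_ (trWith-substF-I d F) (trWith-substF-I d G))
  trWith-substF-I d (_⇒_ {C} F G) = cong ¬¬_ (cong₂ _⇒_ (trWith-substF-I d F) (trWith-substF-I d G))
  trWith-substF-I d (_⇔_ {C} F G) = cong ¬¬_ (cong₂ _⇔_ (trWith-substF-I d F) (trWith-substF-I d G))
  trWith-substF-I d (¬ᶜ F) = cong (λ X → ¬¬ (¬ X)) (trWith-substF-I d F)
  trWith-substF-I d (∃̇ {I} F) = cong ∃̇ (trWith-substF-I (suc d) F)
  trWith-substF-I d (∀̇ {I} F) = cong ∀̇ (trWith-substF-I (suc d) F)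
  trWith-substF-I d (∃̇ {C} F) = cong (λ X → ¬¬ ∃̇ X) (trWith-substF-I (suc d) F)
  trWith-substF-I d (∀̇ {C} F) = cong (λ X → ¬¬ ∀̇ X) (trWith-substF-I (suc d) F)


vars : (m : ℕ) → Vec ℕ m
vars zero    = []
vars (suc m) = m ∷ vars m

∀¹ⁿ : ℕ → MF → MF
∀¹ⁿ zero    M = M
∀¹ⁿ (suc k) M = ∀¹ⁿ k (∀¹ M)

Stable : ℕ → ℕ → MF
Stable m j = ∀¹ⁿ m (atom (stab (pv hat m j (vars m))))

-- Passing under a ∀² over arity-n proper variables: the new variable 0
-- is stable and the old arity-n variables move up by one.
bindStable : ℕ → Stability → Stability
bindStable n S m zero    = if n ≡ᵇ m then true else S m zero
bindStable n S m (suc j) = if n ≡ᵇ m then S m j else S m (suc j)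

trMeta : Stability → Q.MF → MF
trMeta S (Q.atom (s , F))   = atom (trWith S F)
trMeta S (M Q.& N)          = trMeta S M & trMeta S N
trMeta S (M Q.⟹ N)         = trMeta S M ⟹ trMeta S N
trMeta S (Q.∀¹ M)           = ∀¹ (trMeta S M)
trMeta S (Q.∀² (I , n) M)   = ∀² (prob , n) (trMeta S M)
trMeta S (Q.∀² (C , n) M)   = ∀² (hat , n) (Stable n 0 ⟹ trMeta (bindStable n S) M)

∀¹ⁿ-suc : ∀ k M → ∀¹ⁿ (suc k) M ≡ ∀¹ (∀¹ⁿ k M)
∀¹ⁿ-suc zero    M = refl
∀¹ⁿ-suc (suc k) M = ∀¹ⁿ-suc k (∀¹ M)

∀¹ⁿ-mrenI : ∀ k ρ M → mrenI ρ (∀¹ⁿ k M) ≡ ∀¹ⁿ k (mrenI (extN k ρ) M)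
∀¹ⁿ-mrenI zero    ρ M = refl
∀¹ⁿ-mrenI (suc k) ρ M = ∀¹ⁿ-mrenI k ρ (∀¹ M)

∀¹ⁿ-mshiftP : ∀ k b c M → mshiftP b c (∀¹ⁿ k M) ≡ ∀¹ⁿ k (mshiftP b c M)
∀¹ⁿ-mshiftP zero    b c M = refl
∀¹ⁿ-mshiftP (suc k) b c M = ∀¹ⁿ-mshiftP k b c (∀¹ M)

iterate : ℕ → (QF → QF) → QF → QF
iterate zero    f X = X
iterate (suc k) f X = f (iterate k f X)

∀¹ⁿ-msubstP : ∀ k b n j G M →
  msubstP (b , n) j G (∀¹ⁿ k M) ≡ ∀¹ⁿ k (msubstP (b , n) j (iterate k (renQ (extN n suc)) G) M)
∀¹ⁿ-msubstP zero    b n j G M = refl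
∀¹ⁿ-msubstP (suc k) b n j G M = ∀¹ⁿ-msubstP k b n j G (∀¹ M)

-- env ts is the renaming performed by instantiating ∀¹ⁿ k with the terms ts.
env : ∀ {k} → Vec ℕ k → ℕ → ℕ
env {zero}  []       i = i
env {suc k} (t ∷ ts) i = env ts (extN k (sub0 t) i)

∀¹ⁿE : ∀ {Δ} k X → ND Δ (∀¹ⁿ k (atom X)) → (ts : Vec ℕ k) → ND Δ (atom (renQ (env ts) X))
∀¹ⁿE {Δ} zero X D [] = subst (λ Y → ND Δ (atom Y)) (sym (renQ-id (λ i → refl) X)) D
∀¹ⁿE {Δ} (suc k) X D (t ∷ ts) =
  subst (λ Y → ND Δ (atom Y)) (renQ-∘ (env ts) (extN k (sub0 t)) X)
    (∀¹ⁿE k (renQ (extN k (sub0 t)) X)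
      (subst (ND Δ) (∀¹ⁿ-mrenI k (sub0 t) (atom X)) (∀¹E (subst (ND Δ) (∀¹ⁿ-suc k _) D) t)) ts)

extN-< : ∀ k ρ i → i < k → extN k ρ i ≡ i
extN-< (suc k) ρ zero    p       = refl
extN-< (suc k) ρ (suc i) (s≤s p) = cong suc (extN-< k ρ i p)

extN-+ : ∀ k ρ i → extN k ρ (k + i) ≡ k + ρ i
extN-+ zero    ρ i = refl
extN-+ (suc k) ρ i = cong suc (extN-+ k ρ i)

vars-extN : ∀ k ρ m → m ≤ k → Vec.map (extN k ρ) (vars m) ≡ vars m
vars-extN k ρ zero    p = refl
vars-extN k ρ (suc m) p = cong₂ _∷_ (extN-< k ρ m p) (vars-extN k ρ m (≤-trans (n≤1+n m) p))

env-+ : ∀ {k} (ts : Vec ℕ k) i → env ts (k + i) ≡ i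
env-+ []                 i = refl
env-+ {suc k} (t ∷ ts) i rewrite sym (+-suc k i) | extN-+ k (sub0 t) (suc i) = env-+ ts i

env-vars-∷ : ∀ {k} t (ts : Vec ℕ k) m → m ≤ k →
  Vec.map (env (t ∷ ts)) (vars m) ≡ Vec.map (env ts) (vars m)
env-vars-∷ t ts zero p = refl
env-vars-∷ {k} t ts (suc m) p =
  cong₂ _∷_ (cong (env ts) (extN-< k (sub0 t) m p)) (env-vars-∷ t ts m (≤-trans (n≤1+n m) p))

env-vars : ∀ {k} (ts : Vec ℕ k) → Vec.map (env ts) (vars k) ≡ ts
env-vars []                 = refl
env-vars {suc k} (t ∷ ts) = cong₂ _∷_ head (trans (env-vars-∷ t ts k ≤-refl) (env-vars ts))
  where
  head : env ts (extN k (sub0 t) k) ≡ t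
  head = trans (cong (λ i → env ts (extN k (sub0 t) i)) (sym (+-identityʳ k)))
           (trans (cong (env ts) (extN-+ k (sub0 t) 0)) (env-+ ts t))

Stable-instance : ∀ {Δ} m j → ND Δ (Stable m j) → (a : Vec ℕ m) → ND Δ (atom (stab (pv hat m j a)))
Stable-instance {Δ} m j D a =
  subst (λ v → ND Δ (atom (stab (pv hat m j v)))) (env-vars a) (∀¹ⁿE m _ D a)

Stable-mrenI : ∀ ρ m j → mrenI ρ (Stable m j) ≡ Stable m j
Stable-mrenI ρ m j =
  trans (∀¹ⁿ-mrenI m ρ _) (cong (λ v → ∀¹ⁿ m (atom (stab (pv hat m j v)))) (vars-extN m ρ m ≤-refl))

Stable-mshiftP-prob : ∀ n c m j → mshiftP (prob , n) c (Stable m j) ≡ Stable m j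
Stable-mshiftP-prob n c m j = ∀¹ⁿ-mshiftP m (prob , n) c _

Stable-mshiftP-hat : ∀ n c m j →
  mshiftP (hat , n) c (Stable m j) ≡ Stable m (if (n ≡ᵇ m) and (c ≤ᵇ j) then suc j else j)
Stable-mshiftP-hat n c m j = ∀¹ⁿ-mshiftP m (hat , n) c _

Stable-msubstP-prob : ∀ n j G m i → msubstP (prob , n) j G (Stable m i) ≡ Stable m i
Stable-msubstP-prob n j G m i = ∀¹ⁿ-msubstP m prob n j G _

Stable-msubstP-hat : ∀ n j G m → msubstP (hat , n) (if m ≡ᵇ n then suc j else j) G (Stable m 0) ≡ Stable m 0
Stable-msubstP-hat n j G m =
  trans (∀¹ⁿ-msubstP m hat n _ G _) (cong (λ X → ∀¹ⁿ m (atom (stab X))) (variable-0-untouched _))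
  where
  variable-0-untouched : ∀ X →
    substQAt hat n (if m ≡ᵇ n then suc j else j) X 0 hat m 0 (vars m) ≡ pv hat m 0 (vars m)
  variable-0-untouched X with n ≟ m
  ... | no _ = refl
  ... | yes refl rewrite ≡ᵇ-refl n = refl

Stable0-mshiftP-hat : ∀ n n₀ c →
  Stable n₀ (if (n ≡ᵇ n₀) and ((if n₀ ≡ᵇ n then suc c else c) ≤ᵇ 0) then 1 else 0) ≡ Stable n₀ 0
Stable0-mshiftP-hat n n₀ c with n ≟ n₀
... | yes refl rewrite ≡ᵇ-refl n = refl
... | no n≢n₀  rewrite ≢⇒≡ᵇ-false n n₀ n≢n₀ = refl

bindStable-other : ∀ n S m j → (n ≡ᵇ m) ≡ false → bindStable n S m j ≡ S m j
bindStable-other n S m zero    e rewrite e = refl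
bindStable-other n S m (suc j) e rewrite e = refl

bindStable-cong : ∀ n (S S′ : Stability) m → (∀ j → S′ m j ≡ S m j) →
  ∀ j → bindStable n S′ m j ≡ bindStable n S m j
bindStable-cong n S S′ m h zero with n ≡ᵇ m
... | true  = refl
... | false = h zero
bindStable-cong n S S′ m h (suc j) with n ≡ᵇ m
... | true  = h j
... | false = h (suc j)

bindStable-suc : ∀ n S j → bindStable n S n (suc j) ≡ S n j
bindStable-suc n S j rewrite ≡ᵇ-refl n = refl

bindStable-zero : ∀ n S → bindStable n S n zero ≡ true
bindStable-zero n S rewrite ≡ᵇ-refl n = refl

bindStable-shifts : ∀ n S → ShiftsTo S (bindStable n S) n 0
bindStable-shifts n S m j with n ≟ m
... | yes refl rewrite ≡ᵇ-refl n = bindStable-suc n S j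
... | no n≢m   rewrite ≢⇒≡ᵇ-false n m n≢m = bindStable-other n S m j (≢⇒≡ᵇ-false n m n≢m)

bindStable-substs : ∀ n S → SubstsTo S (bindStable n S) n 0
bindStable-substs n S = record { hit = hit′ ; miss = miss′ ; other = other′ }
  where
  hit′ : ∀ j′ → (j′ ≡ᵇ 0) ≡ true → bindStable n S n j′ ≡ true
  hit′ zero e = bindStable-zero n S
  miss′ : ∀ j′ → (j′ ≡ᵇ 0) ≡ false → bindStable n S n j′ ≡ S n (if 0 <ᵇ j′ then pred j′ else j′)
  miss′ (suc j) e = bindStable-suc n S j
  other′ : ∀ m j′ → n ≢ m → bindStable n S m j′ ≡ S m j′
  other′ m j′ n≢m = bindStable-other n S m j′ (≢⇒≡ᵇ-false n m n≢m)

bindStable-ShiftsTo : ∀ n₀ S S′ n c → ShiftsTo S S′ n c →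
  ShiftsTo (bindStable n₀ S) (bindStable n₀ S′) n (if n₀ ≡ᵇ n then suc c else c)
bindStable-ShiftsTo n₀ S S′ n c h m j with n ≟ m
... | no n≢m rewrite ≢⇒≡ᵇ-false n m n≢m =
      bindStable-cong n₀ S S′ m
        (λ j′ → subst (λ b → S′ m (if b and (c ≤ᵇ j′) then suc j′ else j′) ≡ S m j′)
                      (≢⇒≡ᵇ-false n m n≢m) (h m j′)) j
... | yes refl with n₀ ≟ n
...   | no n₀≢n rewrite ≢⇒≡ᵇ-false n₀ n n₀≢n =
        trans (bindStable-other n₀ S′ n _ (≢⇒≡ᵇ-false n₀ n n₀≢n))
              (trans (h n j) (sym (bindStable-other n₀ S n j (≢⇒≡ᵇ-false n₀ n n₀≢n))))
...   | yes refl = same-arity j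
  where
  h′ : ∀ j → S′ n (if c ≤ᵇ j then suc j else j) ≡ S n j
  h′ j = subst (λ b → S′ n (if b and (c ≤ᵇ j) then suc j else j) ≡ S n j) (≡ᵇ-refl n) (h n j)
  same-arity : ∀ j →
    bindStable n S′ n (if (n ≡ᵇ n) and ((if n ≡ᵇ n then suc c else c) ≤ᵇ j) then suc j else j)
    ≡ bindStable n S n j
  same-arity zero rewrite ≡ᵇ-refl n = bindStable-zero n S′
  same-arity (suc j) rewrite ≡ᵇ-refl n | suc≤ᵇsuc c j with c ≤ᵇ j in e
  ... | true  = trans (bindStable-suc n S′ (suc j)) (subst (λ b → S′ n (if b then suc j else j) ≡ S n j) e (h′ j))
  ... | false = trans (bindStable-suc n S′ j) (subst (λ b → S′ n (if b then suc j else j) ≡ S n j) e (h′ j))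

bindStable-miss : ∀ n S S′ j → SubstsTo S S′ n j → ∀ j′ → (j′ ≡ᵇ suc j) ≡ false →
  bindStable n S′ n j′ ≡ bindStable n S n (if (if n ≡ᵇ n then suc j else j) <ᵇ j′ then pred j′ else j′)
bindStable-miss n S S′ j ok zero e rewrite ≡ᵇ-refl n = refl
bindStable-miss n S S′ j ok (suc j₀) e =
  trans (bindStable-suc n S′ j₀)
    (trans (SubstsTo.miss ok j₀ e)
      (trans (step j₀) (cong (λ b → bindStable n S n (if (if b then suc j else j) <ᵇ suc j₀ then j₀ else suc j₀))
                             (sym (≡ᵇ-refl n)))))
  where
  step : ∀ j₀ → S n (if j <ᵇ j₀ then pred j₀ else j₀) ≡ bindStable n S n (if j <ᵇ j₀ then j₀ else suc j₀)
  step j₀ with j <ᵇ j₀ in e₀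
  step zero      | true  = ⊥-elim (<ᵇ-zero j e₀)
  step (suc j₁)  | true  = sym (bindStable-suc n S j₁)
  step j₀        | false = sym (bindStable-suc n S j₀)

bindStable-SubstsTo : ∀ n₀ S S′ n j → SubstsTo S S′ n j →
  SubstsTo (bindStable n₀ S) (bindStable n₀ S′) n (if n₀ ≡ᵇ n then suc j else j)
bindStable-SubstsTo n₀ S S′ n j ok = record { hit = hit′ ; miss = miss′ ; other = other′ }
  where
  open SubstsTo ok
  j₀ : ℕ
  j₀ = if n₀ ≡ᵇ n then suc j else j
  other′ : ∀ m j′ → n ≢ m → bindStable n₀ S′ m j′ ≡ bindStable n₀ S m j′
  other′ m j′ n≢m = bindStable-cong n₀ S S′ m (λ i → other m i n≢m) j′
  hit′ : ∀ j′ → (j′ ≡ᵇ j₀) ≡ true → bindStable n₀ S′ n j′ ≡ true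
  hit′ j′ e with n₀ ≟ n
  hit′ zero     e | yes refl = bindStable-zero n S′
  hit′ (suc j′) e | yes refl =
    trans (bindStable-suc n S′ j′) (hit j′ (subst (λ b → (suc j′ ≡ᵇ (if b then suc j else j)) ≡ true) (≡ᵇ-refl n) e))
  hit′ j′       e | no n₀≢n  =
    trans (bindStable-other n₀ S′ n j′ (≢⇒≡ᵇ-false n₀ n n₀≢n))
          (hit j′ (subst (λ b → (j′ ≡ᵇ (if b then suc j else j)) ≡ true) (≢⇒≡ᵇ-false n₀ n n₀≢n) e))
  miss′ : ∀ j′ → (j′ ≡ᵇ j₀) ≡ false →
    bindStable n₀ S′ n j′ ≡ bindStable n₀ S n (if j₀ <ᵇ j′ then pred j′ else j′)
  miss′ j′ e with n₀ ≟ n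
  ... | no n₀≢n rewrite ≢⇒≡ᵇ-false n₀ n n₀≢n =
        trans (bindStable-other n₀ S′ n j′ (≢⇒≡ᵇ-false n₀ n n₀≢n))
              (trans (miss j′ e) (sym (bindStable-other n₀ S n _ (≢⇒≡ᵇ-false n₀ n n₀≢n))))
  ... | yes refl =
        bindStable-miss n S S′ j ok j′ (subst (λ b → (j′ ≡ᵇ (if b then suc j else j)) ≡ false) (≡ᵇ-refl n) e)

trMeta-mrenI : ∀ S ρ M → trMeta S (Q.mrenI ρ M) ≡ mrenI ρ (trMeta S M)
trMeta-mrenI S ρ (Q.atom (s , F))  = cong atom (trWith-renF S ρ F)
trMeta-mrenI S ρ (M Q.& N)         = cong₂ _&_ (trMeta-mrenI S ρ M) (trMeta-mrenI S ρ N)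
trMeta-mrenI S ρ (M Q.⟹ N)        = cong₂ _⟹_ (trMeta-mrenI S ρ M) (trMeta-mrenI S ρ N)
trMeta-mrenI S ρ (Q.∀¹ M)          = cong ∀¹ (trMeta-mrenI S (ext ρ) M)
trMeta-mrenI S ρ (Q.∀² (I , n) M)  = cong (∀² (prob , n)) (trMeta-mrenI S ρ M)
trMeta-mrenI S ρ (Q.∀² (C , n) M)  =
  cong₂ (λ A B → ∀² (hat , n) (A ⟹ B)) (sym (Stable-mrenI ρ n 0)) (trMeta-mrenI (bindStable n S) ρ M)

trMeta-mshiftP-I : ∀ S n c M → trMeta S (Q.mshiftP (I , n) c M) ≡ mshiftP (prob , n) c (trMeta S M)
trMeta-mshiftP-I S n c (Q.atom (s , F))   = cong atom (trWith-shiftF-I S n c F)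
trMeta-mshiftP-I S n c (M Q.& N)          = cong₂ _&_ (trMeta-mshiftP-I S n c M) (trMeta-mshiftP-I S n c N)
trMeta-mshiftP-I S n c (M Q.⟹ N)         = cong₂ _⟹_ (trMeta-mshiftP-I S n c M) (trMeta-mshiftP-I S n c N)
trMeta-mshiftP-I S n c (Q.∀¹ M)           = cong ∀¹ (trMeta-mshiftP-I S n c M)
trMeta-mshiftP-I S n c (Q.∀² (I , n₀) M)  = cong (∀² (prob , n₀)) (trMeta-mshiftP-I S n _ M)
trMeta-mshiftP-I S n c (Q.∀² (C , n₀) M)  =
  cong₂ (λ A B → ∀² (hat , n₀) (A ⟹ B)) (sym (Stable-mshiftP-prob n c n₀ 0))
        (trMeta-mshiftP-I (bindStable n₀ S) n c M)

trMeta-mshiftP-C : ∀ S S′ n c → ShiftsTo S S′ n c → ∀ M →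
  trMeta S′ (Q.mshiftP (C , n) c M) ≡ mshiftP (hat , n) c (trMeta S M)
trMeta-mshiftP-C S S′ n c h (Q.atom (s , F))  = cong atom (trWith-shiftF-C S S′ n c h F)
trMeta-mshiftP-C S S′ n c h (M Q.& N)         =
  cong₂ _&_ (trMeta-mshiftP-C S S′ n c h M) (trMeta-mshiftP-C S S′ n c h N)
trMeta-mshiftP-C S S′ n c h (M Q.⟹ N)        =
  cong₂ _⟹_ (trMeta-mshiftP-C S S′ n c h M) (trMeta-mshiftP-C S S′ n c h N)
trMeta-mshiftP-C S S′ n c h (Q.∀¹ M)          = cong ∀¹ (trMeta-mshiftP-C S S′ n c h M)
trMeta-mshiftP-C S S′ n c h (Q.∀² (I , n₀) M) = cong (∀² (prob , n₀)) (trMeta-mshiftP-C S S′ n c h M)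
trMeta-mshiftP-C S S′ n c h (Q.∀² (C , n₀) M) =
  cong₂ (λ A B → ∀² (hat , n₀) (A ⟹ B))
    (sym (trans (Stable-mshiftP-hat n _ n₀ 0) (Stable0-mshiftP-hat n n₀ c)))
    (trMeta-mshiftP-C (bindStable n₀ S) (bindStable n₀ S′) n _ (bindStable-ShiftsTo n₀ S S′ n c h) M)

trMeta-msubstP-I : ∀ S n j G M → trMeta S (Q.msubstP (I , n) j G M) ≡ msubstP (prob , n) j (trWith S G) (trMeta S M)
trMeta-msubstP-I S n j G (Q.atom (s , F)) = cong atom (trWith-substF-I S n j G 0 F)
trMeta-msubstP-I S n j G (M Q.& N)        = cong₂ _&_ (trMeta-msubstP-I S n j G M) (trMeta-msubstP-I S n j G N)
trMeta-msubstP-I S n j G (M Q.⟹ N)       = cong₂ _⟹_ (trMeta-msubstP-I S n j G M) (trMeta-msubstP-I S n j G N)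
trMeta-msubstP-I S n j G (Q.∀¹ M) =
  cong ∀¹ (trans (trMeta-msubstP-I S n j (renF (extN n suc) G) M)
                 (cong (λ X → msubstP (prob , n) j X (trMeta S M)) (trWith-renF S (extN n suc) G)))
trMeta-msubstP-I S n j G (Q.∀² (I , n₀) M) =
  cong (∀² (prob , n₀)) (trans (trMeta-msubstP-I S n _ (shiftF I n₀ 0 G) M)
                               (cong (λ X → msubstP (prob , n) _ X (trMeta S M)) (trWith-shiftF-I S n₀ 0 G)))
trMeta-msubstP-I S n j G (Q.∀² (C , n₀) M) =
  cong₂ (λ A B → ∀² (hat , n₀) (A ⟹ B)) (sym (Stable-msubstP-prob n j _ n₀ 0))
    (trans (trMeta-msubstP-I (bindStable n₀ S) n j (shiftF C n₀ 0 G) M)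
           (cong (λ X → msubstP (prob , n) j X (trMeta (bindStable n₀ S) M))
                 (trWith-shiftF-C S (bindStable n₀ S) n₀ 0 (bindStable-shifts n₀ S) G)))

trMeta-msubstP-C : ∀ S S′ n j → SubstsTo S S′ n j → ∀ G M →
  trMeta S (Q.msubstP (C , n) j G M) ≡ msubstP (hat , n) j (trWith S G) (trMeta S′ M)
trMeta-msubstP-C S S′ n j ok G (Q.atom (s , F)) = cong atom (trWith-substF-C S S′ n j G ok 0 F)
trMeta-msubstP-C S S′ n j ok G (M Q.& N) =
  cong₂ _&_ (trMeta-msubstP-C S S′ n j ok G M) (trMeta-msubstP-C S S′ n j ok G N)
trMeta-msubstP-C S S′ n j ok G (M Q.⟹ N) =
  cong₂ _⟹_ (trMeta-msubstP-C S S′ n j ok G M) (trMeta-msubstP-C S S′ n j ok G N)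
trMeta-msubstP-C S S′ n j ok G (Q.∀¹ M) =
  cong ∀¹ (trans (trMeta-msubstP-C S S′ n j ok (renF (extN n suc) G) M)
                 (cong (λ X → msubstP (hat , n) j X (trMeta S′ M)) (trWith-renF S (extN n suc) G)))
trMeta-msubstP-C S S′ n j ok G (Q.∀² (I , n₀) M) =
  cong (∀² (prob , n₀)) (trans (trMeta-msubstP-C S S′ n j ok (shiftF I n₀ 0 G) M)
                               (cong (λ X → msubstP (hat , n) j X (trMeta S′ M)) (trWith-shiftF-I S n₀ 0 G)))
trMeta-msubstP-C S S′ n j ok G (Q.∀² (C , n₀) M) =
  cong₂ (λ A B → ∀² (hat , n₀) (A ⟹ B)) (sym (Stable-msubstP-hat n j _ n₀))
    (trans (trMeta-msubstP-C (bindStable n₀ S) (bindStable n₀ S′) n _ (bindStable-SubstsTo n₀ S S′ n j ok)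
                             (shiftF C n₀ 0 G) M)
           (cong (λ X → msubstP (hat , n) _ X (trMeta (bindStable n₀ S′) M))
                 (trWith-shiftF-C S (bindStable n₀ S) n₀ 0 (bindStable-shifts n₀ S) G)))


𝒟QH-shiftP : ∀ n c → mshiftP (prob , n) c 𝒟QH ≡ 𝒟QH
𝒟QH-shiftP zero          c = refl
𝒟QH-shiftP (suc zero)    c = refl
𝒟QH-shiftP (suc (suc n)) c = refl

record Invariant (S : Stability) (Γ : List Q.MF) (Δ : List MF) : Set where
  field
    hasQH  : 𝒟QH ∈ Δ
    hyps   : ∀ {N} → N ∈ Γ → trMeta S N ∈ Δ
    stable : ∀ m j → S m j ≡ true → Stable m j ∈ Δ
open Invariant

trWith-stable : ∀ {Δ} S → Invariant S [] Δ → (G : Fm C) → ND Δ (atom (stab (trWith S G)))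
trWith-stable S iv (pv n j a) with S n j in eq
... | true  = Stable-instance n j (hyp (stable iv n j eq)) a
... | false = QHProofs.stab-¬¬ (hasQH iv) _
trWith-stable S iv ⊤       = run (lam (thm ax✓))         where open QHProofs (hasQH iv)
trWith-stable S iv ⊥       = run (lam (app #0 (lam #0))) where open QHProofs (hasQH iv)
trWith-stable S iv (¿ Φ)   = QHProofs.stab-¬¬ (hasQH iv) _
trWith-stable S iv (F ∧ G) = QHProofs.stab-¬¬ (hasQH iv) _
trWith-stable S iv (F ∨ G) = QHProofs.stab-¬¬ (hasQH iv) _
trWith-stable S iv (F ⇒ G) = QHProofs.stab-¬¬ (hasQH iv) _
trWith-stable S iv (F ⇔ G) = QHProofs.stab-¬¬ (hasQH iv) _
trWith-stable S iv (¬ᶜ F)  = QHProofs.stab-¬¬ (hasQH iv) _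
trWith-stable S iv (∃̇ F)   = QHProofs.stab-¬¬ (hasQH iv) _
trWith-stable S iv (∀̇ F)   = QHProofs.stab-¬¬ (hasQH iv) _

Invariant-closed : ∀ {S Γ Δ} → Invariant S Γ Δ → Invariant S [] Δ
Invariant-closed iv = record { hasQH = hasQH iv ; hyps = λ () ; stable = stable iv }

Invariant-⟹I : ∀ {S Γ Δ} M → Invariant S Γ Δ → Invariant S (M ∷ Γ) (trMeta S M ∷ Δ)
Invariant-⟹I M iv = record
  { hasQH  = there (hasQH iv)
  ; hyps   = λ { (here refl) → here refl ; (there p) → there (hyps iv p) }
  ; stable = λ m j e → there (stable iv m j e)
  }

Invariant-∀¹I : ∀ {S Γ Δ} → Invariant S Γ Δ → Invariant S (map (Q.mrenI suc) Γ) (map (mrenI suc) Δ)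
Invariant-∀¹I {S} {Γ} {Δ} iv = record
  { hasQH  = ∈-map⁺ (mrenI suc) (hasQH iv)
  ; hyps   = hyps′
  ; stable = λ m j e → subst (_∈ map (mrenI suc) Δ) (Stable-mrenI suc m j) (∈-map⁺ _ (stable iv m j e))
  }
  where
  hyps′ : ∀ {N} → N ∈ map (Q.mrenI suc) Γ → trMeta S N ∈ map (mrenI suc) Δ
  hyps′ p with ∈-map⁻ (Q.mrenI suc) p
  ... | N , q , refl = subst (_∈ map (mrenI suc) Δ) (sym (trMeta-mrenI S suc N)) (∈-map⁺ _ (hyps iv q))

Invariant-∀²I-prob : ∀ {S Γ Δ} n → Invariant S Γ Δ →
  Invariant S (map (Q.mshiftP (I , n) 0) Γ) (map (mshiftP (prob , n) 0) Δ)
Invariant-∀²I-prob {S} {Γ} {Δ} n iv = record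
  { hasQH  = subst (_∈ Δ′) (𝒟QH-shiftP n 0) (∈-map⁺ _ (hasQH iv))
  ; hyps   = hyps′
  ; stable = λ m j e → subst (_∈ Δ′) (Stable-mshiftP-prob n 0 m j) (∈-map⁺ _ (stable iv m j e))
  }
  where
  Δ′ = map (mshiftP (prob , n) 0) Δ
  hyps′ : ∀ {N} → N ∈ map (Q.mshiftP (I , n) 0) Γ → trMeta S N ∈ Δ′
  hyps′ p with ∈-map⁻ (Q.mshiftP (I , n) 0) p
  ... | N , q , refl = subst (_∈ Δ′) (sym (trMeta-mshiftP-I S n 0 N)) (∈-map⁺ _ (hyps iv q))

Invariant-∀²I-hat : ∀ {S Γ Δ} n → Invariant S Γ Δ →
  Invariant (bindStable n S) (map (Q.mshiftP (C , n) 0) Γ) (Stable n 0 ∷ map (mshiftP (hat , n) 0) Δ)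
Invariant-∀²I-hat {S} {Γ} {Δ} n iv = record
  { hasQH  = there (∈-map⁺ _ (hasQH iv))
  ; hyps   = hyps′
  ; stable = stable′
  }
  where
  Δ′ = map (mshiftP (hat , n) 0) Δ
  hyps′ : ∀ {N} → N ∈ map (Q.mshiftP (C , n) 0) Γ → trMeta (bindStable n S) N ∈ Stable n 0 ∷ Δ′
  hyps′ p with ∈-map⁻ (Q.mshiftP (C , n) 0) p
  ... | N , q , refl =
    there (subst (_∈ Δ′) (sym (trMeta-mshiftP-C S (bindStable n S) n 0 (bindStable-shifts n S) N))
                 (∈-map⁺ _ (hyps iv q)))
  stable′ : ∀ m j → bindStable n S m j ≡ true → Stable m j ∈ Stable n 0 ∷ Δ′
  stable′ m j e with n ≟ m
  stable′ m zero    e | yes refl = here refl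
  stable′ m (suc j) e | yes refl = there (subst (_∈ Δ′)
      (trans (Stable-mshiftP-hat n 0 n j) (cong (λ b → Stable n (if b and true then suc j else j)) (≡ᵇ-refl n)))
      (∈-map⁺ _ (stable iv n j (trans (sym (bindStable-suc n S j)) e))))
  stable′ m j       e | no n≢m = there (subst (_∈ Δ′)
      (trans (Stable-mshiftP-hat n 0 m j)
             (cong (λ b → Stable m (if b and (0 ≤ᵇ j) then suc j else j)) (≢⇒≡ᵇ-false n m n≢m)))
      (∈-map⁺ _ (stable iv m j (trans (sym (bindStable-other n S m j (≢⇒≡ᵇ-false n m n≢m))) e))))

mrenIⁿ : ℕ → List MF → List MF
mrenIⁿ zero    Δ = Δ
mrenIⁿ (suc k) Δ = map (mrenI suc) (mrenIⁿ k Δ)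

∀¹ⁿI : ∀ k {Δ M} → ND (mrenIⁿ k Δ) M → ND Δ (∀¹ⁿ k M)
∀¹ⁿI zero    d = d
∀¹ⁿI (suc k) d = ∀¹ⁿI k (∀¹I d)

Invariant-mrenIⁿ : ∀ {S Δ} k → Invariant S [] Δ → Invariant S [] (mrenIⁿ k Δ)
Invariant-mrenIⁿ zero    iv = iv
Invariant-mrenIⁿ (suc k) iv = Invariant-∀¹I (Invariant-mrenIⁿ k iv)

substQAt-hit : ∀ n Y d a → substQAt hat n 0 Y d hat n 0 a ≡ renQ (inst a d) Y
substQAt-hit n Y d a with n ≟ n
... | yes refl = refl
... | no n≢n   = ⊥-elim (n≢n refl)

renFⁿ : ℕ → (ℕ → ℕ) → Fm C → Fm C
renFⁿ zero    ρ G = G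
renFⁿ (suc k) ρ G = renF ρ (renFⁿ k ρ G)

iterate-renQ-trWith : ∀ S k ρ G → iterate k (renQ ρ) (trWith S G) ≡ trWith S (renFⁿ k ρ G)
iterate-renQ-trWith S zero    ρ G = refl
iterate-renQ-trWith S (suc k) ρ G =
  trans (cong (renQ ρ) (iterate-renQ-trWith S k ρ G)) (sym (trWith-renF S ρ (renFⁿ k ρ G)))

Stable-msubstP : ∀ {Δ} S n (G : Fm C) → Invariant S [] Δ →
  ND Δ (msubstP (hat , n) 0 (trWith S G) (Stable n 0))
Stable-msubstP {Δ} S n G iv =
  subst (ND Δ) (sym (∀¹ⁿ-msubstP n hat n 0 (trWith S G) (atom (stab (pv hat n 0 (vars n))))))
    (subst (λ Y → ND Δ (∀¹ⁿ n (atom (stab Y)))) (sym eq)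
      (∀¹ⁿI n (trWith-stable S (Invariant-mrenIⁿ n iv) G′)))
  where
  G′ : Fm C
  G′ = renF (inst (vars n) 0) (renFⁿ n (extN n suc) G)
  eq : substQAt hat n 0 (iterate n (renQ (extN n suc)) (trWith S G)) 0 hat n 0 (vars n) ≡ trWith S G′
  eq = trans (substQAt-hit n _ 0 (vars n))
         (trans (cong (renQ (inst (vars n) 0)) (iterate-renQ-trWith S n (extN n suc) G))
                (sym (trWith-renF S (inst (vars n) 0) (renFⁿ n (extN n suc) G))))

translate : ∀ {Γ M} → Q.ND Γ M → ∀ S Δ → Invariant S Γ Δ → ND Δ (trMeta S M)
translate (Q.hyp p)    S Δ iv = hyp (hyps iv p)
translate (Q.&I d e)   S Δ iv = &I (translate d S Δ iv) (translate e S Δ iv)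
translate (Q.&E₁ d)    S Δ iv = &E₁ (translate d S Δ iv)
translate (Q.&E₂ d)    S Δ iv = &E₂ (translate d S Δ iv)
translate (Q.⟹I {M = M} d) S Δ iv = ⟹I (translate d S _ (Invariant-⟹I M iv))
translate (Q.⟹E d e)  S Δ iv = ⟹E (translate d S Δ iv) (translate e S Δ iv)
translate (Q.∀¹I d)    S Δ iv = ∀¹I (translate d S _ (Invariant-∀¹I iv))
translate (Q.∀¹E {M = M} d t) S Δ iv =
  subst (ND Δ) (sym (trMeta-mrenI S (sub0 t) M)) (∀¹E (translate d S Δ iv) t)
translate (Q.∀²I {k = I , n} d) S Δ iv = ∀²I (translate d S _ (Invariant-∀²I-prob n iv))
translate (Q.∀²I {k = C , n} d) S Δ iv = ∀²I (⟹I (translate d (bindStable n S) _ (Invariant-∀²I-hat n iv)))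
translate (Q.∀²E {M = M} {k = I , n} d G) S Δ iv =
  subst (ND Δ) (sym (trMeta-msubstP-I S n 0 G M)) (∀²E (translate d S Δ iv) (trWith S G))
translate (Q.∀²E {M = M} {k = C , n} d G) S Δ iv =
  subst (ND Δ) (sym (trMeta-msubstP-C S (bindStable n S) n 0 (bindStable-substs n S) G M))
    (⟹E (∀²E (translate d S Δ iv) (trWith S G)) (Stable-msubstP S n G (Invariant-closed iv)))

ND-weaken : ∀ {Γ Γ′ M} → Γ ⊆ Γ′ → ND Γ M → ND Γ′ M
ND-weaken Γ⊆Γ′ (hyp p)   = hyp (Γ⊆Γ′ p)
ND-weaken Γ⊆Γ′ (&I d e)  = &I (ND-weaken Γ⊆Γ′ d) (ND-weaken Γ⊆Γ′ e)
ND-weaken Γ⊆Γ′ (&E₁ d)   = &E₁ (ND-weaken Γ⊆Γ′ d)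
ND-weaken Γ⊆Γ′ (&E₂ d)   = &E₂ (ND-weaken Γ⊆Γ′ d)
ND-weaken Γ⊆Γ′ (⟹I d)   = ⟹I (ND-weaken (∷⁺ʳ _ Γ⊆Γ′) d)
ND-weaken Γ⊆Γ′ (⟹E d e) = ⟹E (ND-weaken Γ⊆Γ′ d) (ND-weaken Γ⊆Γ′ e)
ND-weaken Γ⊆Γ′ (∀¹I d)   = ∀¹I (ND-weaken (⊆-map⁺ _ Γ⊆Γ′) d)
ND-weaken Γ⊆Γ′ (∀¹E d t) = ∀¹E (ND-weaken Γ⊆Γ′ d) t
ND-weaken Γ⊆Γ′ (∀²I d)   = ∀²I (ND-weaken (⊆-map⁺ _ Γ⊆Γ′) d)
ND-weaken Γ⊆Γ′ (∀²E d G) = ∀²E (ND-weaken Γ⊆Γ′ d) G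

p̂ : ℕ → QF
p̂ j = pv hat 0 j []

θ̂ α : ℕ → QF
θ̂ x = pv hat 1 0 (x ∷ [])
α x = pv prob 1 0 (x ∷ [])

StablyQuantified₁ StablyQuantified₂ : MF → MF
StablyQuantified₁ M = ∀² (hat , 0) (Stable 0 0 ⟹ M)
StablyQuantified₂ M = StablyQuantified₁ (StablyQuantified₁ M)

∀²I-stable₁ : ∀ {Δ M} → 𝒟QH ∈ Δ →
  (∀ {Δ′} → 𝒟QH ∈ Δ′ → ND Δ′ (atom (stab (p̂ 0))) → ND Δ′ M) →
  ND Δ (StablyQuantified₁ M)
∀²I-stable₁ hasQH f = ∀²I (⟹I (f (there (∈-map⁺ _ hasQH)) (hyp (here refl))))

∀²I-stable₂ : ∀ {Δ M} → 𝒟QH ∈ Δ →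
  (∀ {Δ′} → 𝒟QH ∈ Δ′ → ND Δ′ (atom (stab (p̂ 1))) → ND Δ′ (atom (stab (p̂ 0))) → ND Δ′ M) →
  ND Δ (StablyQuantified₂ M)
∀²I-stable₂ hasQH f = ∀²I (⟹I (∀²I (⟹I (f (there (∈-map⁺ _ (there (∈-map⁺ _ hasQH))))
  (hyp (there (∈-map⁺ _ (here refl)))) (hyp (here refl))))))

∀²I-stable₃ : ∀ {Δ M} → 𝒟QH ∈ Δ →
  (∀ {Δ′} → 𝒟QH ∈ Δ′ → ND Δ′ (atom (stab (p̂ 2))) → ND Δ′ (atom (stab (p̂ 1))) →
            ND Δ′ (atom (stab (p̂ 0))) → ND Δ′ M) →
  ND Δ (StablyQuantified₁ (StablyQuantified₂ M))
∀²I-stable₃ hasQH f =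
  ∀²I (⟹I (∀²I (⟹I (∀²I (⟹I (f (there (∈-map⁺ _ (there (∈-map⁺ _ (there (∈-map⁺ _ hasQH))))))
    (hyp (there (∈-map⁺ _ (there (∈-map⁺ _ (here refl))))))
    (hyp (there (∈-map⁺ _ (here refl)))) (hyp (here refl))))))))

TranslatesInto : List Q.MF → List MF → Set
TranslatesInto Ns Δ = ∀ M → ND Δ (trMeta unstable M) → ND Δ (trMeta unstable (bigConj Ns M))

module _ {Δ : List MF} (hasQH : 𝒟QH ∈ Δ) where

  trQC-principles : TranslatesInto QHCAx.QCb.principles Δ
  trQC-principles _ rest =
    &I (∀²I-stable₃ hasQH λ h sr sq sp → let open QHProofs h in run (dni (lam (dni (lam #1)))))
    (&I (∀²I-stable₃ hasQH λ h sr sq sp → let open QHProofs h in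
          run (dni (lam (dni (lam (dni (lam (dnImpE sp (dnImpE (stab-¬¬ _) #2 #0) (dnImpE sq #1 #0)))))))))
    (&I (∀²I-stable₃ hasQH λ h sr sq sp → let open QHProofs h in run (dni (lam (dnE sr (dnMap (ax∧₁ _ _) #0)))))
    (&I (∀²I-stable₃ hasQH λ h sr sq sp → let open QHProofs h in run (dni (lam (dnE sq (dnMap (ax∧₂ _ _) #0)))))
    (&I (∀²I-stable₃ hasQH λ h sr sq sp → let open QHProofs h in run (dni (lam (dni (lam (dni (∧i #1 #0)))))))
    (&I (∀²I-stable₃ hasQH λ h sr sq sp → let open QHProofs h in run (dni (lam (dni (∨i₁ #0)))))
    (&I (∀²I-stable₃ hasQH λ h sr sq sp → let open QHProofs h in run (dni (lam (dni (∨i₂ #0)))))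
    (&I (∀²I-stable₃ hasQH λ h sr sq sp → let open QHProofs h in
          run (dni (lam (dni (lam (dni (lam (dnE sp (dnBind #0
            (∨e #0 (dni (dnImpE sp #4 #0)) (dni (dnImpE sp #3 #0))))))))))))
    (&I (∀²I-stable₃ hasQH λ h sr sq sp → let open QHProofs h in run (dni (lam (dnMap (ax⇔₁ _ _) #0))))
    (&I (∀²I-stable₃ hasQH λ h sr sq sp → let open QHProofs h in run (dni (lam (dnMap (ax⇔₂ _ _) #0))))
    (&I (∀²I-stable₃ hasQH λ h sr sq sp → let open QHProofs h in
          run (dni (lam (dni (lam (dni (⇔i (lam (dnImpE sp #2 #0)) (lam (dnImpE sq #1 #0)))))))))
    (&I (∀²I (⟹I (∀¹I (let open QHProofs hasQH′ in run (dni (lam (dnE sθ (dnMap (ax∀E (θ̂ 0) 0) #0))))))))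
    (&I (∀²I (⟹I (∀¹I (let open QHProofs hasQH′ in run (dni (lam (dni (app (thm (ax∃I (θ̂ 0) 0)) #0))))))))
    (&I (QHProofs.ax✓ hasQH)
    (&I (∀²I-stable₁ hasQH λ h sp → let open QHProofs h in run (dni (thm (ax⋏ _))))
    rest))))))))))))))
    where
    Δ′ : List MF
    Δ′ = map (mrenI suc) (Stable 1 0 ∷ map (mshiftP (hat , 1) 0) Δ)
    hasQH′ : 𝒟QH ∈ Δ′
    hasQH′ = ∈-map⁺ _ (there (∈-map⁺ _ hasQH))
    sθ : ND Δ′ (atom (stab (θ̂ 0)))
    sθ = ∀¹E (hyp (∈-map⁺ _ (here refl))) 0

  trQC-rules : TranslatesInto QHCAx.QCb.rules Δ
  trQC-rules _ rest =
    &I (∀²I-stable₂ hasQH λ h s₁ s₀ → ⟹I (let open QHProofs (there h) in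
          run (dnImpE (ND-weaken there s₀) (thm (&E₂ (hyp (here refl)))) (thm (&E₁ (hyp (here refl)))))))
    (&I (∀²I (⟹I (∀²I (⟹I (⟹I (let open QHProofs (hasQH′ _) in
          run (dni (lam (dni (app (thm (rule∀I (p̂ 0) (θ̂ 0) p⇒θ)) #0))))))))))
    (&I (∀²I (⟹I (∀²I (⟹I (⟹I (let open QHProofs (hasQH′ _) in
          run (dni (lam (dnE (sp (¬¬ (θ̂ 0 ⇒ p̂ 0))) (dnMap (rule∃E (p̂ 0) (θ̂ 0) θ⇒p) #0))))))))))
    rest))
    where
    Δ′ : QF → List MF
    Δ′ X = ∀¹ (atom X) ∷ Stable 1 0 ∷ map (mshiftP (hat , 1) 0) (Stable 0 0 ∷ map (mshiftP (hat , 0) 0) Δ)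
    hasQH′ : ∀ X → 𝒟QH ∈ Δ′ X
    hasQH′ X = there (there (∈-map⁺ _ (there (∈-map⁺ _ hasQH))))
    sp : ∀ X → ND (Δ′ X) (atom (stab (p̂ 0)))
    sp X = hyp (there (there (∈-map⁺ _ (here refl))))
    sθ↑ : ∀ X → ND (map (mrenI suc) (Δ′ X)) (atom (stab (θ̂ 0)))
    sθ↑ X = ∀¹E (hyp (∈-map⁺ _ (there (here refl)))) 0
    sp↑ : ∀ X → ND (map (mrenI suc) (Δ′ X)) (atom (stab (p̂ 0)))
    sp↑ X = hyp (∈-map⁺ _ (there (there (∈-map⁺ _ (here refl)))))
    p⇒θ : ND (map (mrenI suc) (Δ′ (¬¬ (p̂ 0 ⇒ θ̂ 0)))) (atom (p̂ 0 ⇒ θ̂ 0))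
    p⇒θ = let open QHProofs (∈-map⁺ (mrenI suc) (hasQH′ _)) in
      run (lam (dnImpE (sθ↑ _) (thm (∀¹E (hyp (∈-map⁺ _ (here refl))) 0)) #0))
    θ⇒p : ND (map (mrenI suc) (Δ′ (¬¬ (θ̂ 0 ⇒ p̂ 0)))) (atom (θ̂ 0 ⇒ p̂ 0))
    θ⇒p = let open QHProofs (∈-map⁺ (mrenI suc) (hasQH′ _)) in
      run (lam (dnImpE (sp↑ _) (thm (∀¹E (hyp (∈-map⁺ _ (here refl))) 0)) #0))

  trClassical : TranslatesInto QHCAx.classical Δ
  trClassical _ rest =
    &I (∀²I-stable₁ hasQH λ h sp → let open QHProofs h in
          run (dni (lam (dnE sp (lam (app #1 (lam (app #0 (dni #1)))))))))
    (&I (∀²I-stable₁ hasQH λ h sp → let open QHProofs h in run (dni (lam #0)))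
    (&I (∀²I-stable₁ hasQH λ h sp → let open QHProofs h in run (dni (lam #0)))
    rest))

  -- On i-formulas the translation is the identity (up to renaming the
  -- problem variables into QH), so these are the axioms of 𝒟QH themselves.
  trQH : TranslatesInto (QHCAx.QHb.principles ++ QHCAx.QHb.rules) Δ
  trQH _ rest =
    &I (axiom 0) (&I (axiom 1) (&I (axiom 2) (&I (axiom 3) (&I (axiom 4) (&I (axiom 5)
    (&I (axiom 6) (&I (axiom 7) (&I (axiom 8) (&I (axiom 9) (&I (axiom 10) (&I (axiom 11)
    (&I (axiom 12) (&I (axiom 13) (&I (axiom 14) (&I (axiom 15) (&I (axiom 16) (&I (axiom 17)
    rest)))))))))))))))))
    where open QHProofs hasQH

  trHybrid : TranslatesInto QHCAx.hybrid Δ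
  trHybrid _ rest =
    &I (∀²I (∀²I (let open QHProofs hasQH₀₀ in
          run (dni (⇔i (lam (dni (∧i (dnMap (ax∧₁ _ _) #0) (dnMap (ax∧₂ _ _) #0))))
                       (lam (dnBind #0 (dnBind (∧e₁ #0) (dnBind (∧e₂ #1) (dni (∧i #1 #0)))))))))))
    (&I (∀²I (∀²I (let open QHProofs hasQH₀₀ in
          run (dni (⇔i (lam (dnBind #0 (dni (∨e #0 (∨i₁ (dni #0)) (∨i₂ (dni #0))))))
                       (lam (dnBind #0 (∨e #0 (dnMap (ax∨₁ _ _) #0) (dnMap (ax∨₂ _ _) #0)))))))))
    (&I (∀²I (∀²I (let open QHProofs hasQH₀₀ in run (dni (lam (dni (lam (dnApp #1 #0))))))))
    (&I (let open QHProofs hasQH in run (dni (lam (app #0 (lam #0)))))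
    (&I (∀²I (let open QHProofs hasQH₁ in
          run (dni (⇔i (lam (dnMap ∃α⇒∃¬¬α #0)) (lam (dnBind #0 (app (thm ∃¬¬α⇒¬¬∃α) #0)))))))
    (&I (∀²I (let open QHProofs hasQH₁ in run (dni (lam (dnMap ∀α⇒∀¬¬α #0)))))
    (&I (∀²I (let open QHProofs hasQH₀ in run (lam (dni #0))))
    (&I (QHProofs.axI hasQH ⋏)
    (&I (∀²I-stable₁ hasQH λ h sp → let open QHProofs h in run (dni (thm sp)))
    (&I (∀²I-stable₁ hasQH λ h sp → let open QHProofs h in run (lam (dni #0)))
    (&I (∀²I-stable₂ hasQH λ h s₁ s₀ → let open QHProofs h in run (lam (lam (dnImpE s₀ #1 #0))))
    (&I (∀²I-stable₁ hasQH λ h sp → ⟹I (hyp (here refl)))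
    (&I (∀²I-stable₁ hasQH λ h sp → ⟹I (hyp (here refl)))
    rest))))))))))))
    where
    hasQH₀ : 𝒟QH ∈ map (mshiftP (prob , 0) 0) Δ
    hasQH₀ = ∈-map⁺ _ hasQH
    hasQH₀₀ : 𝒟QH ∈ map (mshiftP (prob , 0) 0) (map (mshiftP (prob , 0) 0) Δ)
    hasQH₀₀ = ∈-map⁺ _ hasQH₀
    Δ₁ : List MF
    Δ₁ = map (mshiftP (prob , 1) 0) Δ
    hasQH₁ : 𝒟QH ∈ Δ₁
    hasQH₁ = ∈-map⁺ _ hasQH
    hasQH₁↑ : 𝒟QH ∈ map (mrenI suc) Δ₁
    hasQH₁↑ = ∈-map⁺ _ hasQH₁
    ∃α⇒∃¬¬α : ND Δ₁ (atom (∃̇ (α 0) ⇒ ∃̇ (¬¬ α 0)))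
    ∃α⇒∃¬¬α = QHProofs.rule∃E hasQH₁ (∃̇ (¬¬ α 0)) (α 0)
      (let open QHProofs hasQH₁↑ in run (lam (app (thm (ax∃I (¬¬ α 0) 0)) (dni #0))))
    ∃¬¬α⇒¬¬∃α : ND Δ₁ (atom (∃̇ (¬¬ α 0) ⇒ ¬¬ ∃̇ (α 0)))
    ∃¬¬α⇒¬¬∃α = QHProofs.rule∃E hasQH₁ (¬¬ ∃̇ (α 0)) (¬¬ α 0)
      (let open QHProofs hasQH₁↑ in run (lam (dnMap (ax∃I (α 0) 0) #0)))
    ∀α⇒∀¬¬α : ND Δ₁ (atom (∀̇ (α 0) ⇒ ∀̇ (¬¬ α 0)))
    ∀α⇒∀¬¬α = QHProofs.rule∀I hasQH₁ (∀̇ (α 0)) (¬¬ α 0)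
      (let open QHProofs hasQH₁↑ in run (lam (dni (app (thm (ax∀E (α 0) 0)) #0))))

  translatedAxioms : ND Δ (trMeta unstable QHCAx.𝒟QHC)
  translatedAxioms =
    trQC-principles fromQCrules (trQC-rules fromClassical (trClassical fromQH
      (trQH fromHybrid (trHybrid ⌜ ⊤ ⌝ (QHProofs.ax✓ hasQH)))))
    where
    open QHCAx
    fromHybrid fromQH fromClassical fromQCrules : Q.MF
    fromHybrid    = bigConj hybrid ⌜ ⊤ ⌝
    fromQH        = bigConj QHb.principles (bigConj QHb.rules fromHybrid)
    fromClassical = bigConj classical fromQH
    fromQCrules   = bigConj QCb.rules fromClassical

trMeta-conj : ∀ F Fs → trMeta unstable (Q.conj F Fs) ≡ conj (trΣ F) (map trΣ Fs)
trMeta-conj (s , F) []       = cong atom (trWith-unstable F)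
trMeta-conj (s , F) (G ∷ Gs) = cong₂ _&_ (cong atom (trWith-unstable F)) (trMeta-conj G Gs)

trMeta-entails : ∀ As A → trMeta unstable (Q.entails As A) ≡ entails (map trΣ As) (trΣ A)
trMeta-entails []       (s , A) = cong atom (trWith-unstable A)
trMeta-entails (F ∷ Fs) (s , A) = cong₂ _⟹_ (trMeta-conj F Fs) (cong atom (trWith-unstable A))

mainTheorem3 : (As : List Formula) (A : Formula) →
    As ⊢QHC A → map trΣ As ⊢QH trΣ A
mainTheorem3 As A d =
  ⟹I (subst (ND (𝒟QH ∷ [])) (trMeta-entails As A)
        (⟹E (translate d unstable (𝒟QH ∷ []) initial) (translatedAxioms (here refl))))
  where
  initial : Invariant unstable [] (𝒟QH ∷ [])
  initial = record { hasQH = here refl ; hyps = λ () ; stable = λ m j () }
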